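{- Let $N\ge3$, ${\bf x}=(x_1,\ldots,x_N)$, and let $1\le \ell_1<\ell_2<\cdots<\ell_{N-1}$ be integers. For $i\ge1$ let $t_i({\bf x})=x_1$ if $i\le \ell_1$, $t_i({\bf x})=x_j$ if $\ell_{j-1}<i\le \ell_j$ ($2\le j\le N-1$), and $t_i({\bf x})=x_N$ if $i>\ell_{N-1}$. Let $\sigma({\bf x})=1+x_1+\cdots+x_N$. Define polynomials $c_{n,k}({\bf x})$ by $c_{0,0}=1$, $c_{n,k}=0$ unless $0\le k\le n$, and for all $n\ge0$: $c_{n+1,0}=\sigma({\bf x})c_{n,0}+t_1({\bf x})c_{n,1}$ and $c_{n+1,k}=c_{n,k-1}+\sigma({\bf x})c_{n,k}+t_{k+1}({\bf x})c_{n,k+1}$ for $k\ge1$. Then $(c_{n,0}({\bf x}))_{n\ge0}$ is a Stieltjes moment sequence of polynomials.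
   Context: A sequence $(a_k({\bf x}))_{k\ge0}$ of polynomials is a Stieltjes moment sequence of polynomials if every minor of every finite order of the Hankel matrix $[a_{i+j}({\bf x})]_{i,j\ge0}$ is a polynomial in ${\bf x}$ with nonnegative coefficients. -}

module Defs where

open import Data.Nat as ℕ using (ℕ; zero; suc; _≤?_)
open import Data.Integer as ℤ using (ℤ; +_; -_)
open import Data.Fin as Fin using (Fin; zero; suc; punchIn)
open import Data.Vec using (Vec; replicate; zipWith; updateAt)
open import Data.Vec.Properties using (≡-dec)
open import Data.List using (List; []; _∷_; _++_; map; concatMap)
open import Data.Product using (_×_; _,_)
open import Relation.Nullary using (yes; no)
open import Relation.Nullary.Decidable using (does)
open import Data.Bool using (if_then_else_)

-- Multivariate polynomials in N variables x_0,…,x_{N-1} with integer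
-- coefficients, represented as a finite formal sum of terms c·x^e
-- (coefficients of equal monomials are added by `coeff`).

Mono : ℕ → Set
Mono N = Vec ℕ N

Poly : ℕ → Set
Poly N = List (ℤ × Mono N)

StrictlyIncreasing : ∀ {k} → (Fin k → ℕ) → Set
StrictlyIncreasing {k} r = ∀ (a b : Fin k) → a Fin.< b → r a ℕ.< r b

module _ {N : ℕ} where

  coeff : Poly N → Mono N → ℤ
  coeff [] m = + 0
  coeff ((c , e) ∷ p) m with ≡-dec ℕ._≟_ e m
  ... | yes _ = c ℤ.+ coeff p m
  ... | no  _ = coeff p m

  0P : Poly N
  0P = []

  constP : ℤ → Poly N
  constP c = (c , replicate N 0) ∷ []

  1P : Poly N
  1P = constP (+ 1)

  var : Fin N → Poly N
  var i = (+ 1 , updateAt (replicate N 0) i (λ _ → 1)) ∷ []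

  infixl 6 _+P_
  infixl 7 _*P_

  _+P_ : Poly N → Poly N → Poly N
  p +P q = p ++ q

  negP : Poly N → Poly N
  negP = map (λ { (c , e) → (- c , e) })

  _*P_ : Poly N → Poly N → Poly N
  p *P q = concatMap (λ { (c , e) → map (λ { (d , f) → (c ℤ.* d , zipWith ℕ._+_ e f) }) q }) p

  NonnegCoeffs : Poly N → Set
  NonnegCoeffs p = ∀ (m : Mono N) → + 0 ℤ.≤ coeff p m

  sumP : ∀ {k} → (Fin k → Poly N) → Poly N
  sumP {zero}  f = 0P
  sumP {suc k} f = f zero +P sumP (λ j → f (suc j))

  signP : ∀ {k} → Fin k → Poly N → Poly N
  signP zero    p = p
  signP (suc j) p = negP (signP j p)

  det : ∀ k → (Fin k → Fin k → Poly N) → Poly N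
  det zero    M = 1P
  det (suc k) M =
    sumP (λ j → signP j (M zero j *P det k (λ a b → M (suc a) (punchIn j b))))

  -- Stieltjes moment sequence of polynomials: every minor of every finite
  -- order of the Hankel matrix [a_{i+j}]_{i,j≥0} has nonnegative coefficients.
  IsStieltjesMomentSeq : (ℕ → Poly N) → Set
  IsStieltjesMomentSeq a =
    ∀ (k : ℕ) (r s : Fin k → ℕ) → StrictlyIncreasing r → StrictlyIncreasing s →
      NonnegCoeffs (det k (λ i j → a (r i ℕ.+ s j)))

-- The specific sequence. Variables are x_1,…,x_N with N = suc n (so the
-- variables are indexed by Fin (suc n), x_{j+1} ↔ index j), and
-- ℓ : Fin n → ℕ gives ℓ_1 < … < ℓ_{N-1}.

tIdx : ∀ {n} → (Fin n → ℕ) → ℕ → Fin (suc n)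
tIdx {zero}  ℓ i = zero
tIdx {suc n} ℓ i = if does (i ≤? ℓ zero) then zero else suc (tIdx (λ j → ℓ (suc j)) i)

tPoly : ∀ {n} → (Fin n → ℕ) → ℕ → Poly (suc n)
tPoly ℓ i = var (tIdx ℓ i)

σP : ∀ {n} → Poly (suc n)
σP = 1P +P sumP var

cPoly : ∀ {n} → (Fin n → ℕ) → ℕ → ℕ → Poly (suc n)
cPoly ℓ zero    zero    = 1P
cPoly ℓ zero    (suc k) = 0P
cPoly ℓ (suc m) zero    = σP *P cPoly ℓ m 0 +P tPoly ℓ 1 *P cPoly ℓ m 1
cPoly ℓ (suc m) (suc k) =
  cPoly ℓ m k +P σP *P cPoly ℓ m (suc k) +P tPoly ℓ (suc (suc k)) *P cPoly ℓ m (suc (suc k))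

-- Write C = (c_{n,k}) and J for the tridiagonal matrix with subdiagonal 1, diagonal σ and
-- superdiagonal (t_{k+1}), so that row n+1 of C is row n of C times J. Since σ = 1 + t_k + d_k,
-- where d_k is the sum of the other variables, right multiplication by J factors into repetitions
-- and deletions of columns and bidiagonal column operations with coefficients in ℕ[x]. Each of
-- these keeps the maximal minors of a k×∞ matrix nonnegative (det is multilinear in a column and
-- vanishes when two adjacent columns agree), so induction on the row indices shows that every minor
-- of C is nonnegative. The rows (c_{r+j,0})_j of the Hankel matrix arise from the rows (c_{r,j})_j of
-- C by repeating, for p = 0, 1, 2, …, column p and multiplying the part of the row after column p
-- by J, so the Hankel minors are nonnegative too.

module Submission where

open import Defs
open import Data.Nat using (ℕ; suc; _≤_; _<_)
open import Data.Fin using (Fin)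

open import Algebra.Bundles using (CommutativeRing)
open import Algebra.Solver.Ring.AlmostCommutativeRing
  using (AlmostCommutativeRing; fromCommutativeRing; _-Raw-AlmostCommutative⟶_)
open import Data.Bool using (true; false; if_then_else_)
open import Data.Empty using (⊥-elim)
open import Data.Fin as Fin using (toℕ; punchIn; punchOut)
import Data.Fin.Properties as Fin
open import Data.Integer as ℤ using (ℤ; +_; -_)
  renaming (_+_ to _+ℤ_; _*_ to _*ℤ_; _≤_ to _≤ℤ_)
import Data.Integer.Properties as ℤ
open import Data.Integer.Solver using (module +-*-Solver)
open import Data.List using (List; []; _∷_; _++_; map; length)
import Data.List.Properties as List
open import Data.List.Relation.Unary.All using (All; []; _∷_)
open import Data.Maybe using (Maybe; just; nothing)
open import Data.Nat as ℕ using (zero; z≤n; s≤s)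
import Data.Nat.Properties as ℕ
open import Data.Product using (_×_; _,_; ∃-syntax)
open import Data.Sum using (_⊎_; inj₁; inj₂)
open import Data.Vec using (replicate; zipWith)
open import Data.Vec.Functional using (updateAt)
open import Data.Vec.Functional.Properties using (updateAt-updates; updateAt-minimal)
open import Data.Vec.Properties using (≡-dec; zipWith-assoc; zipWith-comm; zipWith-identityˡ)
open import Function using (_∘_)
open import Level using (0ℓ)
open import Relation.Binary using (tri<; tri≈; tri>; _Preserves_⟶_)
open import Relation.Binary.PropositionalEquality
import Relation.Binary.Reasoning.Setoid as SetoidReasoning
open import Relation.Nullary using (Dec; yes; no; ¬_)
open import Relation.Nullary.Decidable using (does)

-- Polynomial arithmetic

infixl 6 _⊕_
_⊕_ : ∀ {N} → Mono N → Mono N → Mono N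
_⊕_ = zipWith ℕ._+_

_≟ᴹ_ : ∀ {N} (e f : Mono N) → Dec (e ≡ f)
_≟ᴹ_ = ≡-dec ℕ._≟_

*-nonneg : ∀ {a b} → + 0 ≤ℤ a → + 0 ≤ℤ b → + 0 ≤ℤ a *ℤ b
*-nonneg {+ m} {+ n} _ _ = subst (+ 0 ≤ℤ_) (ℤ.pos-* m n) (ℤ.+≤+ z≤n)

module _ {N : ℕ} where

  -- Polynomials are compared coefficientwise. The ring laws are checked on the pairing
  -- ⟨ p ∣ h ⟩ = Σ c·h(e), which gives coeff p m for h = δ m and turns *P into a double sum.
  ⟨_∣_⟩ : Poly N → (Mono N → ℤ) → ℤ
  ⟨ [] ∣ h ⟩ = + 0
  ⟨ (c , e) ∷ p ∣ h ⟩ = c *ℤ h e +ℤ ⟨ p ∣ h ⟩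

  δ : Mono N → Mono N → ℤ
  δ m e = if does (e ≟ᴹ m) then + 1 else + 0

  δ-nonneg : ∀ m e → + 0 ≤ℤ δ m e
  δ-nonneg m e with does (e ≟ᴹ m)
  ... | true  = ℤ.+≤+ z≤n
  ... | false = ℤ.+≤+ z≤n

  coeff≡pairing-δ : ∀ p m → coeff p m ≡ ⟨ p ∣ δ m ⟩
  coeff≡pairing-δ [] m = refl
  coeff≡pairing-δ ((c , e) ∷ p) m with e ≟ᴹ m
  ... | yes _ = cong₂ _+ℤ_ (sym (ℤ.*-identityʳ c)) (coeff≡pairing-δ p m)
  ... | no  _ = trans (coeff≡pairing-δ p m)
                      (sym (trans (cong (_+ℤ ⟨ p ∣ δ m ⟩) (ℤ.*-zeroʳ c)) (ℤ.+-identityˡ _)))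

  pairing-cong : ∀ p {h g} → (∀ e → h e ≡ g e) → ⟨ p ∣ h ⟩ ≡ ⟨ p ∣ g ⟩
  pairing-cong [] h≡g = refl
  pairing-cong ((c , e) ∷ p) h≡g = cong₂ _+ℤ_ (cong (c *ℤ_) (h≡g e)) (pairing-cong p h≡g)

  pairing-++ : ∀ p q h → ⟨ p ++ q ∣ h ⟩ ≡ ⟨ p ∣ h ⟩ +ℤ ⟨ q ∣ h ⟩
  pairing-++ [] q h = sym (ℤ.+-identityˡ _)
  pairing-++ ((c , e) ∷ p) q h =
    trans (cong (c *ℤ h e +ℤ_) (pairing-++ p q h)) (sym (ℤ.+-assoc (c *ℤ h e) _ _))

  pairing-negP : ∀ p h → ⟨ negP p ∣ h ⟩ ≡ - ⟨ p ∣ h ⟩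
  pairing-negP [] h = refl
  pairing-negP ((c , e) ∷ p) h =
    trans (cong₂ _+ℤ_ (sym (ℤ.neg-distribˡ-* c (h e))) (pairing-negP p h))
          (sym (ℤ.neg-distrib-+ (c *ℤ h e) _))

  pairing-zero : ∀ p → ⟨ p ∣ (λ _ → + 0) ⟩ ≡ + 0
  pairing-zero [] = refl
  pairing-zero ((c , e) ∷ p) = trans (cong₂ _+ℤ_ (ℤ.*-zeroʳ c) (pairing-zero p)) refl

  pairing-+ : ∀ p h g → ⟨ p ∣ (λ e → h e +ℤ g e) ⟩ ≡ ⟨ p ∣ h ⟩ +ℤ ⟨ p ∣ g ⟩
  pairing-+ [] h g = refl
  pairing-+ ((c , e) ∷ p) h g rewrite pairing-+ p h g =
    solve 5 (λ c x y X Y → c :* (x :+ y) :+ (X :+ Y) := c :* x :+ X :+ (c :* y :+ Y))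
      refl c (h e) (g e) ⟨ p ∣ h ⟩ ⟨ p ∣ g ⟩
    where open +-*-Solver

  pairing-scale : ∀ p a h → ⟨ p ∣ (λ e → a *ℤ h e) ⟩ ≡ a *ℤ ⟨ p ∣ h ⟩
  pairing-scale [] a h = sym (ℤ.*-zeroʳ a)
  pairing-scale ((c , e) ∷ p) a h rewrite pairing-scale p a h =
    solve 4 (λ c a x X → c :* (a :* x) :+ a :* X := a :* (c :* x :+ X)) refl c a (h e) ⟨ p ∣ h ⟩
    where open +-*-Solver

  pairing-swap : ∀ p q (g : Mono N → Mono N → ℤ) →
                 ⟨ p ∣ (λ e → ⟨ q ∣ g e ⟩) ⟩ ≡ ⟨ q ∣ (λ f → ⟨ p ∣ (λ e → g e f) ⟩) ⟩
  pairing-swap [] q g = sym (pairing-zero q)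
  pairing-swap ((c , e) ∷ p) q g = begin
    c *ℤ ⟨ q ∣ g e ⟩ +ℤ ⟨ p ∣ (λ e′ → ⟨ q ∣ g e′ ⟩) ⟩
      ≡⟨ cong₂ _+ℤ_ (sym (pairing-scale q c (g e))) (pairing-swap p q g) ⟩
    ⟨ q ∣ (λ f → c *ℤ g e f) ⟩ +ℤ ⟨ q ∣ (λ f → ⟨ p ∣ (λ e′ → g e′ f) ⟩) ⟩
      ≡⟨ sym (pairing-+ q _ _) ⟩
    ⟨ q ∣ (λ f → c *ℤ g e f +ℤ ⟨ p ∣ (λ e′ → g e′ f) ⟩) ⟩ ∎
    where open ≡-Reasoning

  pairing-map-scale-shift : ∀ c e (g : ℤ × Mono N → ℤ × Mono N) →
                            (∀ d f → g (d , f) ≡ (c *ℤ d , e ⊕ f)) →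
                            ∀ q h → ⟨ map g q ∣ h ⟩ ≡ c *ℤ ⟨ q ∣ (λ f → h (e ⊕ f)) ⟩
  pairing-map-scale-shift c e g g≡ [] h = sym (ℤ.*-zeroʳ c)
  pairing-map-scale-shift c e g g≡ ((d , f) ∷ q) h
    rewrite g≡ d f | pairing-map-scale-shift c e g g≡ q h =
    solve 4 (λ c d x y → c :* d :* x :+ c :* y := c :* (d :* x :+ y)) refl
      c d (h (e ⊕ f)) ⟨ q ∣ (λ f → h (e ⊕ f)) ⟩
    where open +-*-Solver

  pairing-*P : ∀ p q h → ⟨ p *P q ∣ h ⟩ ≡ ⟨ p ∣ (λ e → ⟨ q ∣ (λ f → h (e ⊕ f)) ⟩) ⟩
  pairing-*P [] q h = refl
  pairing-*P ((c , e) ∷ p) q h =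
    trans (pairing-++ (map _ q) (p *P q) h)
          (cong₂ _+ℤ_ (pairing-map-scale-shift c e _ (λ _ _ → refl) q h) (pairing-*P p q h))

  coeff-++ : ∀ p q m → coeff (p ++ q) m ≡ coeff p m +ℤ coeff q m
  coeff-++ p q m = trans (coeff≡pairing-δ (p ++ q) m)
    (trans (pairing-++ p q (δ m)) (sym (cong₂ _+ℤ_ (coeff≡pairing-δ p m) (coeff≡pairing-δ q m))))

  coeff-negP : ∀ p m → coeff (negP p) m ≡ - coeff p m
  coeff-negP p m = trans (coeff≡pairing-δ (negP p) m)
    (trans (pairing-negP p (δ m)) (cong -_ (sym (coeff≡pairing-δ p m))))

  deleteMono : Mono N → Poly N → Poly N
  deleteMono m [] = []
  deleteMono m ((c , e) ∷ p) with e ≟ᴹ m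
  ... | yes _ = deleteMono m p
  ... | no  _ = (c , e) ∷ deleteMono m p

  pairing-deleteMono : ∀ m p h → ⟨ p ∣ h ⟩ ≡ coeff p m *ℤ h m +ℤ ⟨ deleteMono m p ∣ h ⟩
  pairing-deleteMono m [] h = refl
  pairing-deleteMono m ((c , e) ∷ p) h with e ≟ᴹ m
  ... | yes refl rewrite pairing-deleteMono e p h =
    solve 4 (λ c x y z → c :* x :+ (y :* x :+ z) := (c :+ y) :* x :+ z) refl
      c (h e) (coeff p e) ⟨ deleteMono e p ∣ h ⟩
    where open +-*-Solver
  ... | no _ rewrite pairing-deleteMono m p h =
    solve 5 (λ c x y z w → c :* x :+ (y :* z :+ w) := y :* z :+ (c :* x :+ w)) refl
      c (h e) (coeff p m) (h m) ⟨ deleteMono m p ∣ h ⟩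
    where open +-*-Solver

  coeff-deleteMono-≡ : ∀ m p → coeff (deleteMono m p) m ≡ + 0
  coeff-deleteMono-≡ m [] = refl
  coeff-deleteMono-≡ m ((c , e) ∷ p) with e ≟ᴹ m
  ... | yes _ = coeff-deleteMono-≡ m p
  ... | no e≢m with e ≟ᴹ m
  ...   | yes e≡m = ⊥-elim (e≢m e≡m)
  ...   | no  _   = coeff-deleteMono-≡ m p

  coeff-deleteMono-≢ : ∀ m p {f} → ¬ f ≡ m → coeff (deleteMono m p) f ≡ coeff p f
  coeff-deleteMono-≢ m [] f≢m = refl
  coeff-deleteMono-≢ m ((c , e) ∷ p) {f} f≢m with e ≟ᴹ m
  ... | yes refl with e ≟ᴹ f
  ...   | yes refl = ⊥-elim (f≢m refl)
  ...   | no  _    = coeff-deleteMono-≢ m p f≢m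
  coeff-deleteMono-≢ m ((c , e) ∷ p) {f} f≢m | no _ with e ≟ᴹ f
  ...   | yes _ = cong (c +ℤ_) (coeff-deleteMono-≢ m p f≢m)
  ...   | no  _ = coeff-deleteMono-≢ m p f≢m

  length-deleteMono : ∀ m p → length (deleteMono m p) ≤ length p
  length-deleteMono m [] = z≤n
  length-deleteMono m ((c , e) ∷ p) with e ≟ᴹ m
  ... | yes _ = ℕ.m≤n⇒m≤1+n (length-deleteMono m p)
  ... | no  _ = s≤s (length-deleteMono m p)

  length-deleteMono-head : ∀ c e p → length (deleteMono e ((c , e) ∷ p)) < length ((c , e) ∷ p)
  length-deleteMono-head c e p with e ≟ᴹ e
  ... | yes _   = s≤s (length-deleteMono e p)
  ... | no e≢e = ⊥-elim (e≢e refl)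

  deleteMono-induction : ∀ {ℓ} (P : Poly N → Set ℓ) → P [] →
                         (∀ p m → P (deleteMono m p) → P p) → ∀ p → P p
  deleteMono-induction P P[] step p = go (suc (length p)) p ℕ.≤-refl
    where
    go : ∀ n p → length p < n → P p
    go (suc n) [] _ = P[]
    go (suc n) ((c , e) ∷ p) ∣p∣<n = step _ e
      (go n _ (ℕ.<-≤-trans (length-deleteMono-head c e p) (ℕ.s≤s⁻¹ ∣p∣<n)))

  coeff-deleteMono-preserves : ∀ (Q : ℤ → Set) → Q (+ 0) → ∀ m p →
                               (∀ f → Q (coeff p f)) → ∀ f → Q (coeff (deleteMono m p) f)
  coeff-deleteMono-preserves Q Q0 m p Qp f with f ≟ᴹ m
  ... | yes refl = subst Q (sym (coeff-deleteMono-≡ f p)) Q0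
  ... | no f≢m  = subst Q (sym (coeff-deleteMono-≢ m p f≢m)) (Qp f)

  infix 4 _≈_
  record _≈_ (p q : Poly N) : Set where
    constructor mk≈
    field coeff-≡ : ∀ m → coeff p m ≡ coeff q m
  open _≈_ public

  pairing-vanishes : ∀ p → p ≈ 0P → ∀ h → ⟨ p ∣ h ⟩ ≡ + 0
  pairing-vanishes = deleteMono-induction _ (λ _ _ → refl) step
    where
    step : ∀ p m → (deleteMono m p ≈ 0P → ∀ h → ⟨ deleteMono m p ∣ h ⟩ ≡ + 0) →
           p ≈ 0P → ∀ h → ⟨ p ∣ h ⟩ ≡ + 0
    step p m ih p≈0 h = begin
      ⟨ p ∣ h ⟩                                       ≡⟨ pairing-deleteMono m p h ⟩
      coeff p m *ℤ h m +ℤ ⟨ deleteMono m p ∣ h ⟩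
        ≡⟨ cong₂ (λ a b → a *ℤ h m +ℤ b) (coeff-≡ p≈0 m) (ih del≈0 h) ⟩
      + 0                                             ∎
      where
      open ≡-Reasoning
      del≈0 : deleteMono m p ≈ 0P
      del≈0 = mk≈ (coeff-deleteMono-preserves (_≡ + 0) refl m p (coeff-≡ p≈0))

  pairing-nonneg : ∀ p → NonnegCoeffs p → ∀ h → (∀ e → + 0 ≤ℤ h e) → + 0 ≤ℤ ⟨ p ∣ h ⟩
  pairing-nonneg = deleteMono-induction _ (λ _ _ _ → ℤ.≤-refl) step
    where
    Claim : Poly N → Set
    Claim p = NonnegCoeffs p → ∀ h → (∀ e → + 0 ≤ℤ h e) → + 0 ≤ℤ ⟨ p ∣ h ⟩
    step : ∀ p m → Claim (deleteMono m p) → Claim p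
    step p m ih p≥0 h h≥0 =
      subst (+ 0 ≤ℤ_) (sym (pairing-deleteMono m p h))
        (ℤ.+-mono-≤ (*-nonneg (p≥0 m) (h≥0 m))
                    (ih (coeff-deleteMono-preserves (+ 0 ≤ℤ_) ℤ.≤-refl m p p≥0) h h≥0))

  pairing-≈ : ∀ {p q} → p ≈ q → ∀ h → ⟨ p ∣ h ⟩ ≡ ⟨ q ∣ h ⟩
  pairing-≈ {p} {q} p≈q h = ℤ.i-j≡0⇒i≡j _ _ (begin
    ⟨ p ∣ h ⟩ +ℤ - ⟨ q ∣ h ⟩         ≡⟨ cong (⟨ p ∣ h ⟩ +ℤ_) (sym (pairing-negP q h)) ⟩
    ⟨ p ∣ h ⟩ +ℤ ⟨ negP q ∣ h ⟩      ≡⟨ sym (pairing-++ p (negP q) h) ⟩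
    ⟨ p ++ negP q ∣ h ⟩              ≡⟨ pairing-vanishes (p ++ negP q) difference≈0 h ⟩
    + 0                              ∎)
    where
    open ≡-Reasoning
    difference≈0 : p ++ negP q ≈ 0P
    difference≈0 = mk≈ λ m → begin
      coeff (p ++ negP q) m            ≡⟨ coeff-++ p (negP q) m ⟩
      coeff p m +ℤ coeff (negP q) m    ≡⟨ cong₂ _+ℤ_ (coeff-≡ p≈q m) (coeff-negP q m) ⟩
      coeff q m +ℤ - coeff q m         ≡⟨ ℤ.+-inverseʳ (coeff q m) ⟩
      + 0                              ∎

  ≈-from-pairing : ∀ {p q} → (∀ m → ⟨ p ∣ δ m ⟩ ≡ ⟨ q ∣ δ m ⟩) → p ≈ q
  ≈-from-pairing {p} {q} eq =
    mk≈ λ m → trans (coeff≡pairing-δ p m) (trans (eq m) (sym (coeff≡pairing-δ q m)))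

  ≈-refl : ∀ {p} → p ≈ p
  ≈-refl = mk≈ λ _ → refl

  ≈-reflexive : ∀ {p q} → p ≡ q → p ≈ q
  ≈-reflexive refl = ≈-refl

  ≈-sym : ∀ {p q} → p ≈ q → q ≈ p
  ≈-sym p≈q = mk≈ λ m → sym (coeff-≡ p≈q m)

  ≈-trans : ∀ {p q r} → p ≈ q → q ≈ r → p ≈ r
  ≈-trans p≈q q≈r = mk≈ λ m → trans (coeff-≡ p≈q m) (coeff-≡ q≈r m)

  +P-cong : ∀ {p p′ q q′} → p ≈ p′ → q ≈ q′ → p +P q ≈ p′ +P q′
  +P-cong {p} {p′} {q} {q′} p≈p′ q≈q′ = mk≈ λ m →
    trans (coeff-++ p q m) (trans (cong₂ _+ℤ_ (coeff-≡ p≈p′ m) (coeff-≡ q≈q′ m)) (sym (coeff-++ p′ q′ m)))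

  negP-cong : ∀ {p q} → p ≈ q → negP p ≈ negP q
  negP-cong {p} {q} p≈q = mk≈ λ m →
    trans (coeff-negP p m) (trans (cong -_ (coeff-≡ p≈q m)) (sym (coeff-negP q m)))

  *P-cong : ∀ {p p′ q q′} → p ≈ p′ → q ≈ q′ → p *P q ≈ p′ *P q′
  *P-cong {p} {p′} {q} {q′} p≈p′ q≈q′ = ≈-from-pairing λ m → begin
    ⟨ p *P q ∣ δ m ⟩                                       ≡⟨ pairing-*P p q (δ m) ⟩
    ⟨ p ∣ (λ e → ⟨ q ∣ (λ f → δ m (e ⊕ f)) ⟩) ⟩            ≡⟨ pairing-≈ p≈p′ _ ⟩
    ⟨ p′ ∣ (λ e → ⟨ q ∣ (λ f → δ m (e ⊕ f)) ⟩) ⟩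
                                                           ≡⟨ pairing-cong p′ (λ e → pairing-≈ q≈q′ _) ⟩
    ⟨ p′ ∣ (λ e → ⟨ q′ ∣ (λ f → δ m (e ⊕ f)) ⟩) ⟩          ≡⟨ sym (pairing-*P p′ q′ (δ m)) ⟩
    ⟨ p′ *P q′ ∣ δ m ⟩                                     ∎
    where open ≡-Reasoning

  +P-assoc : ∀ p q r → (p +P q) +P r ≈ p +P (q +P r)
  +P-assoc p q r = mk≈ λ m → cong (λ s → coeff s m) (List.++-assoc p q r)

  +P-comm : ∀ p q → p +P q ≈ q +P p
  +P-comm p q = mk≈ λ m →
    trans (coeff-++ p q m) (trans (ℤ.+-comm (coeff p m) (coeff q m)) (sym (coeff-++ q p m)))

  +P-identityˡ : ∀ p → 0P +P p ≈ p
  +P-identityˡ p = ≈-refl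

  +P-identityʳ : ∀ p → p +P 0P ≈ p
  +P-identityʳ p = mk≈ λ m → cong (λ s → coeff s m) (List.++-identityʳ p)

  negP-inverseˡ : ∀ p → negP p +P p ≈ 0P
  negP-inverseˡ p = mk≈ λ m →
    trans (coeff-++ (negP p) p m) (trans (cong (_+ℤ coeff p m) (coeff-negP p m)) (ℤ.+-inverseˡ (coeff p m)))

  negP-inverseʳ : ∀ p → p +P negP p ≈ 0P
  negP-inverseʳ p = ≈-trans (+P-comm p (negP p)) (negP-inverseˡ p)

  *P-assoc : ∀ p q r → (p *P q) *P r ≈ p *P (q *P r)
  *P-assoc p q r = ≈-from-pairing λ m → begin
    ⟨ (p *P q) *P r ∣ δ m ⟩
      ≡⟨ trans (pairing-*P (p *P q) r (δ m)) (pairing-*P p q _) ⟩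
    ⟨ p ∣ (λ e → ⟨ q ∣ (λ f → ⟨ r ∣ (λ g → δ m ((e ⊕ f) ⊕ g)) ⟩) ⟩) ⟩
      ≡⟨ pairing-cong p (λ e → pairing-cong q λ f → pairing-cong r λ g →
           cong (δ m) (zipWith-assoc ℕ.+-assoc e f g)) ⟩
    ⟨ p ∣ (λ e → ⟨ q ∣ (λ f → ⟨ r ∣ (λ g → δ m (e ⊕ (f ⊕ g))) ⟩) ⟩) ⟩
      ≡⟨ sym (pairing-cong p λ e → pairing-*P q r _) ⟩
    ⟨ p ∣ (λ e → ⟨ q *P r ∣ (λ f → δ m (e ⊕ f)) ⟩) ⟩
      ≡⟨ sym (pairing-*P p (q *P r) (δ m)) ⟩
    ⟨ p *P (q *P r) ∣ δ m ⟩ ∎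
    where open ≡-Reasoning

  *P-comm : ∀ p q → p *P q ≈ q *P p
  *P-comm p q = ≈-from-pairing λ m → begin
    ⟨ p *P q ∣ δ m ⟩                                  ≡⟨ pairing-*P p q (δ m) ⟩
    ⟨ p ∣ (λ e → ⟨ q ∣ (λ f → δ m (e ⊕ f)) ⟩) ⟩       ≡⟨ pairing-swap p q _ ⟩
    ⟨ q ∣ (λ f → ⟨ p ∣ (λ e → δ m (e ⊕ f)) ⟩) ⟩       ≡⟨ pairing-cong q (λ f → pairing-cong p λ e →
                                                           cong (δ m) (zipWith-comm ℕ.+-comm e f)) ⟩
    ⟨ q ∣ (λ f → ⟨ p ∣ (λ e → δ m (f ⊕ e)) ⟩) ⟩       ≡⟨ sym (pairing-*P q p (δ m)) ⟩
    ⟨ q *P p ∣ δ m ⟩                                  ∎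
    where open ≡-Reasoning

  *P-identityˡ : ∀ p → 1P *P p ≈ p
  *P-identityˡ p = ≈-from-pairing λ m → begin
    ⟨ 1P *P p ∣ δ m ⟩                                       ≡⟨ pairing-*P 1P p (δ m) ⟩
    + 1 *ℤ ⟨ p ∣ (λ f → δ m (replicate N 0 ⊕ f)) ⟩ +ℤ + 0  ≡⟨ trans (ℤ.+-identityʳ _) (ℤ.*-identityˡ _) ⟩
    ⟨ p ∣ (λ f → δ m (replicate N 0 ⊕ f)) ⟩
      ≡⟨ pairing-cong p (λ f → cong (δ m) (zipWith-identityˡ ℕ.+-identityˡ f)) ⟩
    ⟨ p ∣ δ m ⟩                                             ∎
    where open ≡-Reasoning

  *P-identityʳ : ∀ p → p *P 1P ≈ p
  *P-identityʳ p = ≈-trans (*P-comm p 1P) (*P-identityˡ p)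

  *P-zeroʳ : ∀ (p : Poly N) → p *P 0P ≈ 0P
  *P-zeroʳ p = ≈-from-pairing λ m → trans (pairing-*P p 0P (δ m)) (pairing-zero p)

  *P-distribˡ-+P : ∀ p q r → p *P (q +P r) ≈ p *P q +P p *P r
  *P-distribˡ-+P p q r = ≈-from-pairing λ m → begin
    ⟨ p *P (q +P r) ∣ δ m ⟩
      ≡⟨ pairing-*P p (q +P r) (δ m) ⟩
    ⟨ p ∣ (λ e → ⟨ q +P r ∣ (λ f → δ m (e ⊕ f)) ⟩) ⟩
      ≡⟨ trans (pairing-cong p (λ e → pairing-++ q r _)) (pairing-+ p _ _) ⟩
    ⟨ p ∣ (λ e → ⟨ q ∣ (λ f → δ m (e ⊕ f)) ⟩) ⟩ +ℤ
    ⟨ p ∣ (λ e → ⟨ r ∣ (λ f → δ m (e ⊕ f)) ⟩) ⟩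
      ≡⟨ sym (cong₂ _+ℤ_ (pairing-*P p q (δ m)) (pairing-*P p r (δ m))) ⟩
    ⟨ p *P q ∣ δ m ⟩ +ℤ ⟨ p *P r ∣ δ m ⟩
      ≡⟨ sym (pairing-++ (p *P q) (p *P r) (δ m)) ⟩
    ⟨ p *P q +P p *P r ∣ δ m ⟩ ∎
    where open ≡-Reasoning

  *P-distribʳ-+P : ∀ p q r → (q +P r) *P p ≈ q *P p +P r *P p
  *P-distribʳ-+P p q r =
    ≈-trans (*P-comm (q +P r) p) (≈-trans (*P-distribˡ-+P p q r) (+P-cong (*P-comm p q) (*P-comm p r)))

polyRing : ℕ → CommutativeRing 0ℓ 0ℓ
polyRing N = record
  { Carrier = Poly N ; _≈_ = _≈_ ; _+_ = _+P_ ; _*_ = _*P_ ; -_ = negP ; 0# = 0P ; 1# = 1P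
  ; isCommutativeRing = record
    { isRing = record
      { +-isAbelianGroup = record
        { isGroup = record
          { isMonoid = record
            { isSemigroup = record
              { isMagma = record
                { isEquivalence = record { refl = ≈-refl ; sym = ≈-sym ; trans = ≈-trans }
                ; ∙-cong = +P-cong }
              ; assoc = +P-assoc }
            ; identity = +P-identityˡ , +P-identityʳ }
          ; inverse = negP-inverseˡ , negP-inverseʳ
          ; ⁻¹-cong = negP-cong }
        ; comm = +P-comm }
      ; *-cong = *P-cong ; *-assoc = *P-assoc ; *-identity = *P-identityˡ , *P-identityʳ
      ; distrib = *P-distribˡ-+P , *P-distribʳ-+P }
    ; *-comm = *P-comm } }

module PolySolver (N : ℕ) where

  -- Zero is sent to the empty sum so that `con (+ 0) :* p` evaluates to `0P *P p ≡ 0P`.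
  fromℤ : ℤ → Poly N
  fromℤ (+ zero) = 0P
  fromℤ c        = constP c

  pairing-fromℤ : ∀ c h → ⟨ fromℤ c ∣ h ⟩ ≡ c *ℤ h (replicate N 0)
  pairing-fromℤ (+ zero)    h = refl
  pairing-fromℤ (+ suc n)   h = ℤ.+-identityʳ _
  pairing-fromℤ ℤ.-[1+ n ]  h = ℤ.+-identityʳ _

  fromℤ-homomorphism : CommutativeRing.rawRing ℤ.+-*-commutativeRing
                       -Raw-AlmostCommutative⟶ fromCommutativeRing (polyRing N)
  fromℤ-homomorphism = record
    { ⟦_⟧ = fromℤ
    ; +-homo = λ c d → ≈-from-pairing λ m → begin
        ⟨ fromℤ (c +ℤ d) ∣ δ m ⟩                    ≡⟨ pairing-fromℤ (c +ℤ d) (δ m) ⟩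
        (c +ℤ d) *ℤ δ m 0̂                           ≡⟨ ℤ.*-distribʳ-+ (δ m 0̂) c d ⟩
        c *ℤ δ m 0̂ +ℤ d *ℤ δ m 0̂
          ≡⟨ sym (cong₂ _+ℤ_ (pairing-fromℤ c (δ m)) (pairing-fromℤ d (δ m))) ⟩
        ⟨ fromℤ c ∣ δ m ⟩ +ℤ ⟨ fromℤ d ∣ δ m ⟩       ≡⟨ sym (pairing-++ (fromℤ c) (fromℤ d) (δ m)) ⟩
        ⟨ fromℤ c +P fromℤ d ∣ δ m ⟩                ∎
    ; *-homo = λ c d → ≈-from-pairing λ m → begin
        ⟨ fromℤ (c *ℤ d) ∣ δ m ⟩                    ≡⟨ pairing-fromℤ (c *ℤ d) (δ m) ⟩
        c *ℤ d *ℤ δ m 0̂                             ≡⟨ ℤ.*-assoc c d (δ m 0̂) ⟩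
        c *ℤ (d *ℤ δ m 0̂)
          ≡⟨ cong (λ e → c *ℤ (d *ℤ δ m e)) (sym (zipWith-identityˡ ℕ.+-identityˡ 0̂)) ⟩
        c *ℤ (d *ℤ δ m (0̂ ⊕ 0̂))                     ≡⟨ cong (c *ℤ_) (sym (pairing-fromℤ d _)) ⟩
        c *ℤ ⟨ fromℤ d ∣ (λ f → δ m (0̂ ⊕ f)) ⟩      ≡⟨ sym (pairing-fromℤ c _) ⟩
        ⟨ fromℤ c ∣ (λ e → ⟨ fromℤ d ∣ (λ f → δ m (e ⊕ f)) ⟩) ⟩
                                                    ≡⟨ sym (pairing-*P (fromℤ c) (fromℤ d) (δ m)) ⟩
        ⟨ fromℤ c *P fromℤ d ∣ δ m ⟩                ∎
    ; -‿homo = λ c → ≈-from-pairing λ m → begin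
        ⟨ fromℤ (- c) ∣ δ m ⟩                       ≡⟨ pairing-fromℤ (- c) (δ m) ⟩
        - c *ℤ δ m 0̂                                ≡⟨ sym (ℤ.neg-distribˡ-* c (δ m 0̂)) ⟩
        - (c *ℤ δ m 0̂)                              ≡⟨ cong -_ (sym (pairing-fromℤ c (δ m))) ⟩
        - ⟨ fromℤ c ∣ δ m ⟩                         ≡⟨ sym (pairing-negP (fromℤ c) (δ m)) ⟩
        ⟨ negP (fromℤ c) ∣ δ m ⟩                    ∎
    ; 0-homo = ≈-refl
    ; 1-homo = ≈-refl }
    where
    open ≡-Reasoning
    0̂ = replicate N 0

  fromℤ-≟ : ∀ c d → Maybe (fromℤ c ≈ fromℤ d)
  fromℤ-≟ c d with c ℤ.≟ d
  ... | yes refl = just ≈-refl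
  ... | no  _    = nothing

  open import Algebra.Solver.Ring (CommutativeRing.rawRing ℤ.+-*-commutativeRing)
    (fromCommutativeRing (polyRing N)) fromℤ-homomorphism fromℤ-≟ public

module _ {N : ℕ} where

  NonnegCoeffs-≈ : ∀ {p q : Poly N} → p ≈ q → NonnegCoeffs p → NonnegCoeffs q
  NonnegCoeffs-≈ p≈q p≥0 m = subst (+ 0 ≤ℤ_) (coeff-≡ p≈q m) (p≥0 m)

  NonnegCoeffs-0P : NonnegCoeffs (0P {N})
  NonnegCoeffs-0P m = ℤ.≤-refl

  NonnegCoeffs-+P : ∀ (p q : Poly N) → NonnegCoeffs p → NonnegCoeffs q → NonnegCoeffs (p +P q)
  NonnegCoeffs-+P p q p≥0 q≥0 m = subst (+ 0 ≤ℤ_) (sym (coeff-++ p q m)) (ℤ.+-mono-≤ (p≥0 m) (q≥0 m))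

  NonnegCoeffs-*P : ∀ (p q : Poly N) → NonnegCoeffs p → NonnegCoeffs q → NonnegCoeffs (p *P q)
  NonnegCoeffs-*P p q p≥0 q≥0 m =
    subst (+ 0 ≤ℤ_) (sym (trans (coeff≡pairing-δ (p *P q) m) (pairing-*P p q (δ m))))
      (pairing-nonneg p p≥0 _ λ e → pairing-nonneg q q≥0 _ λ f → δ-nonneg m (e ⊕ f))

  NonnegCoeffs-monomial : ∀ n e → NonnegCoeffs {N} ((+ n , e) ∷ [])
  NonnegCoeffs-monomial n e m =
    subst (+ 0 ≤ℤ_) (sym (coeff≡pairing-δ ((+ n , e) ∷ []) m))
      (ℤ.+-mono-≤ (*-nonneg {+ n} (ℤ.+≤+ z≤n) (δ-nonneg m e)) (ℤ.≤-refl {+ 0}))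

  NonnegCoeffs-1P : NonnegCoeffs (1P {N})
  NonnegCoeffs-1P = NonnegCoeffs-monomial 1 (replicate N 0)

  NonnegCoeffs-var : ∀ i → NonnegCoeffs (var {N} i)
  NonnegCoeffs-var i = NonnegCoeffs-monomial 1 (Data.Vec.updateAt (replicate N 0) i (λ _ → 1))

  NonnegCoeffs-sumP : ∀ {k} (f : Fin k → Poly N) → (∀ j → NonnegCoeffs (f j)) → NonnegCoeffs (sumP f)
  NonnegCoeffs-sumP {zero}  f f≥0 = NonnegCoeffs-0P
  NonnegCoeffs-sumP {suc k} f f≥0 =
    NonnegCoeffs-+P (f Fin.zero) _ (f≥0 Fin.zero) (NonnegCoeffs-sumP (λ j → f (Fin.suc j)) (λ j → f≥0 (Fin.suc j)))

-- Determinants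

punchOut-adjacent : ∀ {n} {j u v : Fin (suc n)} (j≢u : j ≢ u) (j≢v : j ≢ v) → toℕ v ≡ suc (toℕ u) →
                    toℕ (punchOut j≢v) ≡ suc (toℕ (punchOut j≢u))
punchOut-adjacent {j = Fin.zero} {Fin.zero} j≢u j≢v v=u+1 = ⊥-elim (j≢u refl)
punchOut-adjacent {j = Fin.zero} {Fin.suc u} {Fin.suc v} j≢u j≢v v=u+1 = ℕ.suc-injective v=u+1
punchOut-adjacent {suc n} {Fin.suc Fin.zero} {Fin.zero} {Fin.suc Fin.zero} j≢u j≢v refl = ⊥-elim (j≢v refl)
punchOut-adjacent {suc (suc n)} {Fin.suc (Fin.suc j)} {Fin.zero} {Fin.suc Fin.zero} j≢u j≢v refl = refl
punchOut-adjacent {suc n} {Fin.suc j} {Fin.suc u} {Fin.suc v} j≢u j≢v v=u+1 =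
  cong suc (punchOut-adjacent (j≢u ∘ cong Fin.suc) (j≢v ∘ cong Fin.suc) (ℕ.suc-injective v=u+1))

punchIn-adjacent : ∀ {n} {u v : Fin (suc n)} → toℕ v ≡ suc (toℕ u) → ∀ b →
                   punchIn u b ≡ punchIn v b ⊎ (punchIn u b ≡ v × punchIn v b ≡ u)
punchIn-adjacent {u = Fin.zero} {Fin.suc Fin.zero} refl Fin.zero    = inj₂ (refl , refl)
punchIn-adjacent {u = Fin.zero} {Fin.suc Fin.zero} refl (Fin.suc b) = inj₁ refl
punchIn-adjacent {suc n} {Fin.suc u} {Fin.suc v} v=u+1 Fin.zero    = inj₁ refl
punchIn-adjacent {suc n} {Fin.suc u} {Fin.suc v} v=u+1 (Fin.suc b) with punchIn-adjacent (ℕ.suc-injective v=u+1) b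
... | inj₁ eq          = inj₁ (cong Fin.suc eq)
... | inj₂ (eq₁ , eq₂) = inj₂ (cong Fin.suc eq₁ , cong Fin.suc eq₂)

module _ {N : ℕ} where
  open PolySolver N using (solve; _:+_; _:*_; :-_; _:=_)
  open SetoidReasoning (CommutativeRing.setoid (polyRing N))

  signP-0P : ∀ {k} (j : Fin k) → signP j (0P {N}) ≡ 0P
  signP-0P Fin.zero    = refl
  signP-0P (Fin.suc j) = cong negP (signP-0P j)

  signP-cong : ∀ {k} (j : Fin k) {p q : Poly N} → p ≈ q → signP j p ≈ signP j q
  signP-cong Fin.zero    p≈q = p≈q
  signP-cong (Fin.suc j) p≈q = negP-cong (signP-cong j p≈q)

  signP-linear : ∀ {k} (j : Fin k) (a c X Y : Poly N) →
                 signP j (a *P X +P c *P Y) ≈ a *P signP j X +P c *P signP j Y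
  signP-linear Fin.zero    a c X Y = ≈-refl
  signP-linear (Fin.suc j) a c X Y = ≈-trans (negP-cong (signP-linear j a c X Y))
    (solve 4 (λ a c X Y → :- (a :* X :+ c :* Y) := a :* (:- X) :+ c :* (:- Y)) ≈-refl
       a c (signP j X) (signP j Y))

  signP-adjacent : ∀ {k} {u v : Fin k} → toℕ v ≡ suc (toℕ u) → ∀ (X : Poly N) →
                   signP v X ≈ negP (signP u X)
  signP-adjacent {u = Fin.zero}  {Fin.suc Fin.zero} refl X = ≈-refl
  signP-adjacent {u = Fin.suc u} {Fin.suc v}        v=u+1 X =
    negP-cong (signP-adjacent (ℕ.suc-injective v=u+1) X)

  sumP-cong : ∀ {k} {f g : Fin k → Poly N} → (∀ j → f j ≈ g j) → sumP f ≈ sumP g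
  sumP-cong {zero}  f≈g = ≈-refl
  sumP-cong {suc k} f≈g = +P-cong (f≈g Fin.zero) (sumP-cong (λ j → f≈g (Fin.suc j)))

  sumP-linear : ∀ {k} (f : Fin k → Poly N) (a c : Poly N) (X Y : Fin k → Poly N) →
                (∀ j → f j ≈ a *P X j +P c *P Y j) → sumP f ≈ a *P sumP X +P c *P sumP Y
  sumP-linear {zero}  f a c X Y f≈ = ≈-sym (+P-cong (*P-zeroʳ a) (*P-zeroʳ c))
  sumP-linear {suc k} f a c X Y f≈ = begin
    f Fin.zero +P sumP (λ j → f (Fin.suc j))
      ≈⟨ +P-cong (f≈ Fin.zero) (sumP-linear _ a c _ _ (λ j → f≈ (Fin.suc j))) ⟩
    (a *P X₀ +P c *P Y₀) +P (a *P Xs +P c *P Ys)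
      ≈⟨ solve 6 (λ a c x y X Y → a :* x :+ c :* y :+ (a :* X :+ c :* Y) := a :* (x :+ X) :+ c :* (y :+ Y))
           ≈-refl a c X₀ Y₀ Xs Ys ⟩
    a *P (X₀ +P Xs) +P c *P (Y₀ +P Ys) ∎
    where
    X₀ = X Fin.zero
    Y₀ = Y Fin.zero
    Xs = sumP (λ j → X (Fin.suc j))
    Ys = sumP (λ j → Y (Fin.suc j))

  sumP-vanishes : ∀ {k} (f : Fin k → Poly N) → (∀ j → f j ≈ 0P) → sumP f ≈ 0P
  sumP-vanishes {zero}  f f≈0 = ≈-refl
  sumP-vanishes {suc k} f f≈0 = +P-cong (f≈0 Fin.zero) (sumP-vanishes _ (λ j → f≈0 (Fin.suc j)))

  sumP-vanishes-but-adjacent : ∀ {k} (f : Fin k → Poly N) {u v : Fin k} → toℕ v ≡ suc (toℕ u) →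
                               (∀ j → j ≢ u → j ≢ v → f j ≈ 0P) → f u +P f v ≈ 0P → sumP f ≈ 0P
  sumP-vanishes-but-adjacent f {Fin.zero} {Fin.suc Fin.zero} refl f≈0 cancel = begin
    f₀ +P (f₁ +P sumP (λ j → f (Fin.suc (Fin.suc j))))
      ≈⟨ +P-cong (≈-refl {p = f₀}) (+P-cong (≈-refl {p = f₁})
           (sumP-vanishes _ (λ j → f≈0 (Fin.suc (Fin.suc j)) (λ ()) (λ ())))) ⟩
    f₀ +P (f₁ +P 0P)    ≈⟨ +P-cong (≈-refl {p = f₀}) (+P-identityʳ f₁) ⟩
    f₀ +P f₁            ≈⟨ cancel ⟩
    0P                  ∎
    where
    f₀ = f Fin.zero
    f₁ = f (Fin.suc Fin.zero)
  sumP-vanishes-but-adjacent f {Fin.suc u} {Fin.suc v} v=u+1 f≈0 cancel =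
    +P-cong (f≈0 Fin.zero (λ ()) (λ ()))
      (sumP-vanishes-but-adjacent _ (ℕ.suc-injective v=u+1)
        (λ j j≢u j≢v → f≈0 (Fin.suc j) (j≢u ∘ Fin.suc-injective) (j≢v ∘ Fin.suc-injective)) cancel)

  minor : ∀ {k} → Fin (suc k) → (Fin (suc k) → Fin (suc k) → Poly N) → Fin k → Fin k → Poly N
  minor j M a b = M (Fin.suc a) (punchIn j b)

  det-cong : ∀ k {M M′ : Fin k → Fin k → Poly N} → (∀ a b → M a b ≈ M′ a b) → det k M ≈ det k M′
  det-cong zero    M≈M′ = ≈-refl
  det-cong (suc k) M≈M′ = sumP-cong λ j →
    signP-cong j (*P-cong (M≈M′ Fin.zero j) (det-cong k (λ a b → M≈M′ (Fin.suc a) (punchIn j b))))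

  det-linear-in-column : ∀ k (M M₁ M₂ : Fin k → Fin k → Poly N) (q : Fin k) (a c : Poly N) →
    (∀ i j → j ≢ q → M i j ≈ M₁ i j) → (∀ i j → j ≢ q → M i j ≈ M₂ i j) →
    (∀ i → M i q ≈ a *P M₁ i q +P c *P M₂ i q) →
    det k M ≈ a *P det k M₁ +P c *P det k M₂
  det-linear-in-column (suc k) M M₁ M₂ q a c M≈M₁ M≈M₂ Mq = sumP-linear _ a c _ _ λ j →
    ≈-trans (signP-cong j (expansion-term j)) (signP-linear j a c _ _)
    where
    expansion-term : ∀ j → M Fin.zero j *P det k (minor j M) ≈
                           a *P (M₁ Fin.zero j *P det k (minor j M₁)) +P c *P (M₂ Fin.zero j *P det k (minor j M₂))
    expansion-term j with j Fin.≟ q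
    ... | yes refl = begin
      M Fin.zero j *P D
        ≈⟨ *P-cong (Mq Fin.zero) (≈-refl {p = D}) ⟩
      (a *P M₁ Fin.zero j +P c *P M₂ Fin.zero j) *P D
        ≈⟨ solve 5 (λ a c x y D → (a :* x :+ c :* y) :* D := a :* (x :* D) :+ c :* (y :* D))
             ≈-refl a c (M₁ Fin.zero j) (M₂ Fin.zero j) D ⟩
      a *P (M₁ Fin.zero j *P D) +P c *P (M₂ Fin.zero j *P D)
        ≈⟨ +P-cong (*P-cong (≈-refl {p = a}) (*P-cong (≈-refl {p = M₁ Fin.zero j}) (same-minor M≈M₁)))
                   (*P-cong (≈-refl {p = c}) (*P-cong (≈-refl {p = M₂ Fin.zero j}) (same-minor M≈M₂))) ⟩
      a *P (M₁ Fin.zero j *P det k (minor j M₁)) +P c *P (M₂ Fin.zero j *P det k (minor j M₂)) ∎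
      where
      D = det k (minor j M)
      same-minor : ∀ {M′} → (∀ i j′ → j′ ≢ j → M i j′ ≈ M′ i j′) → D ≈ det k (minor j M′)
      same-minor M≈M′ = det-cong k (λ x b → M≈M′ (Fin.suc x) (punchIn j b) (Fin.punchInᵢ≢i j b))
    ... | no j≢q = begin
      M Fin.zero j *P det k (minor j M)
        ≈⟨ *P-cong (≈-refl {p = M Fin.zero j}) minor-linear ⟩
      M Fin.zero j *P (a *P D₁ +P c *P D₂)
        ≈⟨ solve 5 (λ a c x D₁ D₂ → x :* (a :* D₁ :+ c :* D₂) := a :* (x :* D₁) :+ c :* (x :* D₂))
             ≈-refl a c (M Fin.zero j) D₁ D₂ ⟩
      a *P (M Fin.zero j *P D₁) +P c *P (M Fin.zero j *P D₂)
        ≈⟨ +P-cong (*P-cong (≈-refl {p = a}) (*P-cong (M≈M₁ Fin.zero j j≢q) (≈-refl {p = D₁})))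
                   (*P-cong (≈-refl {p = c}) (*P-cong (M≈M₂ Fin.zero j j≢q) (≈-refl {p = D₂}))) ⟩
      a *P (M₁ Fin.zero j *P D₁) +P c *P (M₂ Fin.zero j *P D₂) ∎
      where
      D₁ = det k (minor j M₁)
      D₂ = det k (minor j M₂)
      q′ = punchOut j≢q
      off-q′ : ∀ {b} → b ≢ q′ → punchIn j b ≢ q
      off-q′ b≢q′ eq = b≢q′ (Fin.punchIn-injective j _ q′ (trans eq (sym (Fin.punchIn-punchOut j≢q))))
      minor-linear : det k (minor j M) ≈ a *P D₁ +P c *P D₂
      minor-linear = det-linear-in-column k (minor j M) (minor j M₁) (minor j M₂) q′ a c
        (λ x b b≢q′ → M≈M₁ (Fin.suc x) (punchIn j b) (off-q′ b≢q′))
        (λ x b b≢q′ → M≈M₂ (Fin.suc x) (punchIn j b) (off-q′ b≢q′))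
        (λ x → subst (λ z → M (Fin.suc x) z ≈ a *P M₁ (Fin.suc x) z +P c *P M₂ (Fin.suc x) z)
                     (sym (Fin.punchIn-punchOut j≢q)) (Mq (Fin.suc x)))

  det-adjacent-equal-columns : ∀ k (M : Fin k → Fin k → Poly N) {u v : Fin k} → toℕ v ≡ suc (toℕ u) →
                               (∀ i → M i u ≈ M i v) → det k M ≈ 0P
  det-adjacent-equal-columns (suc k) M {u} {v} v=u+1 Mu≈Mv =
    sumP-vanishes-but-adjacent _ v=u+1 other-terms cancelling-pair
    where
    term : Fin (suc k) → Poly N
    term j = signP j (M Fin.zero j *P det k (minor j M))
    other-terms : ∀ j → j ≢ u → j ≢ v → term j ≈ 0P
    other-terms j j≢u j≢v = begin
      term j                          ≈⟨ signP-cong j (*P-cong (≈-refl {p = M Fin.zero j}) minor≈0) ⟩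
      signP j (M Fin.zero j *P 0P)    ≈⟨ signP-cong j (*P-zeroʳ (M Fin.zero j)) ⟩
      signP j 0P                      ≡⟨ signP-0P j ⟩
      0P                              ∎
      where
      minor≈0 : det k (minor j M) ≈ 0P
      minor≈0 = det-adjacent-equal-columns k (minor j M) (punchOut-adjacent j≢u j≢v v=u+1) λ i →
        subst₂ (λ z w → M (Fin.suc i) z ≈ M (Fin.suc i) w)
          (sym (Fin.punchIn-punchOut j≢u)) (sym (Fin.punchIn-punchOut j≢v)) (Mu≈Mv (Fin.suc i))
    same-minors : det k (minor v M) ≈ det k (minor u M)
    same-minors = det-cong k λ a b → entry a (punchIn-adjacent v=u+1 b)
      where
      entry : ∀ a {b} → punchIn u b ≡ punchIn v b ⊎ (punchIn u b ≡ v × punchIn v b ≡ u) →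
              M (Fin.suc a) (punchIn v b) ≈ M (Fin.suc a) (punchIn u b)
      entry a (inj₁ eq)          rewrite eq        = ≈-refl
      entry a (inj₂ (eq₁ , eq₂)) rewrite eq₁ | eq₂ = Mu≈Mv (Fin.suc a)
    cancelling-pair : term u +P term v ≈ 0P
    cancelling-pair = begin
      term u +P term v
        ≈⟨ +P-cong (≈-refl {p = term u}) (signP-adjacent v=u+1 _) ⟩
      term u +P negP (signP u (M Fin.zero v *P det k (minor v M)))
        ≈⟨ +P-cong (≈-refl {p = term u}) (negP-cong (signP-cong u (*P-cong (≈-sym (Mu≈Mv Fin.zero)) same-minors))) ⟩
      term u +P negP (term u)
        ≈⟨ negP-inverseʳ (term u) ⟩
      0P ∎


  omit : ∀ {k} → Fin k → (Fin k → Poly N) → Fin k → Poly N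
  omit x f j with j Fin.≟ x
  ... | yes _ = 0P
  ... | no  _ = f j

  omit-suc : ∀ {k} (x : Fin k) f j → omit (Fin.suc x) f (Fin.suc j) ≡ omit x (f ∘ Fin.suc) j
  omit-suc x f j with Fin.suc j Fin.≟ Fin.suc x | j Fin.≟ x
  ... | yes _       | yes _  = refl
  ... | no  _       | no  _  = refl
  ... | yes sj≡sx   | no j≢x = ⊥-elim (j≢x (Fin.suc-injective sj≡sx))
  ... | no  sj≢sx   | yes j≡x = ⊥-elim (sj≢sx (cong Fin.suc j≡x))

  sumP-omit : ∀ {k} (f : Fin k → Poly N) x → sumP f ≈ f x +P sumP (omit x f)
  sumP-omit f Fin.zero    = ≈-refl
  sumP-omit f (Fin.suc x) = begin
    f₀ +P sumP (f ∘ Fin.suc)                     ≈⟨ +P-cong (≈-refl {p = f₀}) (sumP-omit (f ∘ Fin.suc) x) ⟩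
    f₀ +P (f (Fin.suc x) +P sumP (omit x (f ∘ Fin.suc)))
      ≈⟨ solve 3 (λ a b c → a :+ (b :+ c) := b :+ (a :+ c)) ≈-refl f₀ (f (Fin.suc x)) (sumP (omit x (f ∘ Fin.suc))) ⟩
    f (Fin.suc x) +P (f₀ +P sumP (omit x (f ∘ Fin.suc)))
      ≈⟨ +P-cong (≈-refl {p = f (Fin.suc x)}) (+P-cong (≈-refl {p = f₀})
           (sumP-cong λ j → ≈-reflexive (sym (omit-suc x f j)))) ⟩
    f (Fin.suc x) +P sumP (omit (Fin.suc x) f) ∎
    where f₀ = f Fin.zero

-- Column operations keeping maximal minors nonnegative

module _ {k : ℕ} {s : Fin k → ℕ} (s↑ : StrictlyIncreasing s) where

  StrictlyIncreasing-injective : ∀ {a b} → s a ≡ s b → a ≡ b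
  StrictlyIncreasing-injective {a} {b} sa≡sb with Fin.<-cmp a b
  ... | tri< a<b _ _ = ⊥-elim (ℕ.<-irrefl sa≡sb (s↑ a b a<b))
  ... | tri≈ _ a≡b _ = a≡b
  ... | tri> _ _ b<a = ⊥-elim (ℕ.<-irrefl (sym sa≡sb) (s↑ b a b<a))

  StrictlyIncreasing-adjacent : ∀ {q r i} → s q ≡ i → s r ≡ suc i → toℕ r ≡ suc (toℕ q)
  StrictlyIncreasing-adjacent {q} {r} {i} sq≡i sr≡i+1 with ℕ.<-cmp (toℕ r) (suc (toℕ q))
  ... | tri≈ _ r≡q+1 _ = r≡q+1
  ... | tri< r<q+1 _ _ with ℕ.m≤n⇒m<n∨m≡n (ℕ.s≤s⁻¹ r<q+1)
  ...   | inj₁ r<q = ⊥-elim (ℕ.<-asym (subst₂ _<_ sr≡i+1 sq≡i (s↑ r q r<q)) (ℕ.n<1+n i))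
  ...   | inj₂ r≡q = ⊥-elim (ℕ.1+n≢n (trans (sym sr≡i+1) (trans (cong s (Fin.toℕ-injective r≡q)) sq≡i)))
  StrictlyIncreasing-adjacent {q} {r} {i} sq≡i sr≡i+1 | tri> _ _ q+1<r =
    ⊥-elim (ℕ.<⇒≱ (subst (_< s m) sq≡i (s↑ q m q<m)) (ℕ.s≤s⁻¹ (subst (s m <_) sr≡i+1 (s↑ m r m<r))))
    where
    m : Fin k
    m = Fin.fromℕ< (ℕ.<-trans q+1<r (Fin.toℕ<n r))
    toℕ-m : toℕ m ≡ suc (toℕ q)
    toℕ-m = Fin.toℕ-fromℕ< (ℕ.<-trans q+1<r (Fin.toℕ<n r))
    q<m : q Fin.< m
    q<m = subst (toℕ q <_) (sym toℕ-m) (ℕ.n<1+n (toℕ q))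
    m<r : m Fin.< r
    m<r = subst (_< toℕ r) (sym toℕ-m) q+1<r

  updateAt-strictlyIncreasing : ∀ {q i} → s q ≡ i → (∀ r → s r ≢ suc i) →
                                StrictlyIncreasing (updateAt s q (λ _ → suc i))
  updateAt-strictlyIncreasing {q} {i} sq≡i i+1∉s x y x<y with x Fin.≟ q | y Fin.≟ q
  ... | yes refl | yes refl = ⊥-elim (Fin.<-irrefl refl x<y)
  ... | yes refl | no y≢q = begin-strict
    updateAt s x _ x   ≡⟨ updateAt-updates x s ⟩
    suc i              <⟨ ℕ.≤∧≢⇒< (subst (_< s y) sq≡i (s↑ x y x<y)) (λ i+1≡sy → i+1∉s y (sym i+1≡sy)) ⟩
    s y                ≡⟨ sym (updateAt-minimal y x s y≢q) ⟩
    updateAt s x _ y   ∎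
    where open ℕ.≤-Reasoning
  ... | no x≢q | yes refl = begin-strict
    updateAt s y _ x   ≡⟨ updateAt-minimal x y s x≢q ⟩
    s x                <⟨ subst (s x <_) sq≡i (s↑ x y x<y) ⟩
    i                  <⟨ ℕ.n<1+n i ⟩
    suc i              ≡⟨ sym (updateAt-updates y s) ⟩
    updateAt s y _ y   ∎
    where open ℕ.≤-Reasoning
  ... | no x≢q | no y≢q =
    subst₂ _<_ (sym (updateAt-minimal x q s x≢q)) (sym (updateAt-minimal y q s y≢q)) (s↑ x y x<y)

StrictlyIncreasing-cons : ∀ {k} (u : Fin (suc (suc k)) → ℕ) → u Fin.zero < u (Fin.suc Fin.zero) →
                          StrictlyIncreasing (u ∘ Fin.suc) → StrictlyIncreasing u
StrictlyIncreasing-cons u u₀<u₁ u↑ Fin.zero    (Fin.suc Fin.zero)     _   = u₀<u₁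
StrictlyIncreasing-cons u u₀<u₁ u↑ Fin.zero    (Fin.suc (Fin.suc b))  _   =
  ℕ.<-trans u₀<u₁ (u↑ Fin.zero (Fin.suc b) (s≤s z≤n))
StrictlyIncreasing-cons u u₀<u₁ u↑ (Fin.suc a) (Fin.suc b)            a<b = u↑ a b (ℕ.s≤s⁻¹ a<b)

WeaklyIncreasing : ∀ {k} → (Fin k → ℕ) → Set
WeaklyIncreasing u = ∀ a b → a Fin.< b → u a ≤ u b

strictlyIncreasing-or-adjacentRepeat :
  ∀ k (u : Fin k → ℕ) → WeaklyIncreasing u →
  StrictlyIncreasing u ⊎ ∃[ x ] ∃[ y ] toℕ y ≡ suc (toℕ x) × u x ≡ u y
strictlyIncreasing-or-adjacentRepeat zero          u u↗ = inj₁ λ ()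
strictlyIncreasing-or-adjacentRepeat (suc zero)    u u↗ = inj₁ λ { Fin.zero Fin.zero () }
strictlyIncreasing-or-adjacentRepeat (suc (suc k)) u u↗
  with u Fin.zero ℕ.<? u (Fin.suc Fin.zero)
     | strictlyIncreasing-or-adjacentRepeat (suc k) (u ∘ Fin.suc) (λ a b a<b → u↗ (Fin.suc a) (Fin.suc b) (s≤s a<b))
... | no u₀≮u₁ | _ =
  inj₂ (Fin.zero , Fin.suc Fin.zero , refl , ℕ.≤∧≮⇒≡ (u↗ Fin.zero (Fin.suc Fin.zero) (s≤s z≤n)) u₀≮u₁)
... | yes _     | inj₂ (x , y , y=x+1 , ux≡uy) = inj₂ (Fin.suc x , Fin.suc y , cong suc y=x+1 , ux≡uy)
... | yes u₀<u₁ | inj₁ u↑ = inj₁ (StrictlyIncreasing-cons u u₀<u₁ u↑)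

upperBound : ∀ {k} → (Fin k → ℕ) → ℕ
upperBound {zero}  s = 0
upperBound {suc k} s = suc (s Fin.zero) ℕ.+ upperBound (s ∘ Fin.suc)

<-upperBound : ∀ {k} (s : Fin k → ℕ) j → s j < upperBound s
<-upperBound s Fin.zero    = ℕ.m≤m+n _ _
<-upperBound s (Fin.suc j) = ℕ.<-≤-trans (<-upperBound (s ∘ Fin.suc) j) (ℕ.m≤n+m _ _)

module _ {N : ℕ} where

  MaximalMinorsNonneg : ∀ k → (Fin k → ℕ → Poly N) → Set
  MaximalMinorsNonneg k F = ∀ (s : Fin k → ℕ) → StrictlyIncreasing s → NonnegCoeffs (det k (λ a b → F a (s b)))

  PreservesMaximalMinorsNonneg : ((ℕ → Poly N) → ℕ → Poly N) → Set
  PreservesMaximalMinorsNonneg T = ∀ k F → MaximalMinorsNonneg k F → MaximalMinorsNonneg k (λ a → T (F a))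

  MaximalMinorsNonneg-cong : ∀ {k F G} → (∀ a j → F a j ≈ G a j) → MaximalMinorsNonneg k F → MaximalMinorsNonneg k G
  MaximalMinorsNonneg-cong {k} F≈G F≥0 s s↑ = NonnegCoeffs-≈ (det-cong k λ a b → F≈G a (s b)) (F≥0 s s↑)

  PreservesMaximalMinorsNonneg-cong : ∀ {T T′} → (∀ v j → T v j ≈ T′ v j) →
                               PreservesMaximalMinorsNonneg T → PreservesMaximalMinorsNonneg T′
  PreservesMaximalMinorsNonneg-cong T≈T′ T-pres k F F≥0 = MaximalMinorsNonneg-cong (λ a → T≈T′ (F a)) (T-pres k F F≥0)

  reindex-preservesMaximalMinorsNonneg : ∀ {h} → h Preserves _≤_ ⟶ _≤_ → PreservesMaximalMinorsNonneg (λ v j → v (h j))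
  reindex-preservesMaximalMinorsNonneg {h} h↗ k F F≥0 s s↑
    with strictlyIncreasing-or-adjacentRepeat k (h ∘ s) (λ a b a<b → h↗ (ℕ.<⇒≤ (s↑ a b a<b)))
  ... | inj₁ hs↑                      = F≥0 (h ∘ s) hs↑
  ... | inj₂ (x , y , y=x+1 , hsx≡hsy) =
    NonnegCoeffs-≈ (≈-sym (det-adjacent-equal-columns k _ y=x+1 λ a → ≈-reflexive (cong (F a) hsx≡hsy)))
      NonnegCoeffs-0P

  combineColumn : ℕ → Poly N → Poly N → (ℕ → Poly N) → ℕ → Poly N
  combineColumn i a c v j with j ℕ.≟ i
  ... | yes _ = a *P v i +P c *P v (suc i)
  ... | no  _ = v j

  combineColumn-≡ : ∀ i a c v → combineColumn i a c v i ≡ a *P v i +P c *P v (suc i)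
  combineColumn-≡ i a c v with i ℕ.≟ i
  ... | yes _   = refl
  ... | no i≢i = ⊥-elim (i≢i refl)

  combineColumn-≢ : ∀ {i j} a c v → j ≢ i → combineColumn i a c v j ≡ v j
  combineColumn-≢ {i} {j} a c v j≢i with j ℕ.≟ i
  ... | yes j≡i = ⊥-elim (j≢i j≡i)
  ... | no _    = refl

  MaximalMinorsNonneg-nextColumn : ∀ {k F} → MaximalMinorsNonneg k F → ∀ {s} → StrictlyIncreasing s →
                                   ∀ {q i} → s q ≡ i →
                                   NonnegCoeffs (det k (λ x b → F x (updateAt s q (λ _ → suc i) b)))
  MaximalMinorsNonneg-nextColumn {k} {F} F≥0 {s} s↑ {q} {i} sq≡i with Fin.any? (λ r → s r ℕ.≟ suc i)
  ... | no  i+1∉s          = F≥0 _ (updateAt-strictlyIncreasing s↑ sq≡i (λ r → i+1∉s ∘ (r ,_)))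
  ... | yes (r , sr≡i+1) =
    NonnegCoeffs-≈ (≈-sym (det-adjacent-equal-columns k _ r=q+1 λ x → ≈-reflexive (cong (F x) (begin
      updateAt s q _ q   ≡⟨ updateAt-updates q s ⟩
      suc i              ≡⟨ sym sr≡i+1 ⟩
      s r                ≡⟨ sym (updateAt-minimal r q s r≢q) ⟩
      updateAt s q _ r   ∎))))
      NonnegCoeffs-0P
    where
    open ≡-Reasoning
    r=q+1 : toℕ r ≡ suc (toℕ q)
    r=q+1 = StrictlyIncreasing-adjacent s↑ sq≡i sr≡i+1
    r≢q : r ≢ q
    r≢q r≡q = ℕ.1+n≢n (trans (sym r=q+1) (cong toℕ r≡q))

  combineColumn-preservesMaximalMinorsNonneg : ∀ i {a c} → NonnegCoeffs a → NonnegCoeffs c →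
                                               PreservesMaximalMinorsNonneg (combineColumn i a c)
  combineColumn-preservesMaximalMinorsNonneg i {a} {c} a≥0 c≥0 k F F≥0 s s↑ with Fin.any? (λ q → s q ℕ.≟ i)
  ... | no i∉s = NonnegCoeffs-≈ (det-cong k λ x b → ≈-reflexive (sym (combineColumn-≢ a c (F x) (i∉s ∘ (b ,_)))))
                   (F≥0 s s↑)
  ... | yes (q , sq≡i) = NonnegCoeffs-≈ (≈-sym linear)
          (NonnegCoeffs-+P (a *P det k M₁) (c *P det k M₂)
            (NonnegCoeffs-*P a (det k M₁) a≥0 (F≥0 s s↑))
            (NonnegCoeffs-*P c (det k M₂) c≥0 (MaximalMinorsNonneg-nextColumn {F = F} F≥0 s↑ sq≡i)))
    where
    s′ : Fin k → ℕ
    s′ = updateAt s q (λ _ → suc i)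
    M M₁ M₂ : Fin k → Fin k → Poly N
    M  x b = combineColumn i a c (F x) (s b)
    M₁ x b = F x (s b)
    M₂ x b = F x (s′ b)
    b≢q⇒sb≢i : ∀ {b} → b ≢ q → s b ≢ i
    b≢q⇒sb≢i b≢q sb≡i = b≢q (StrictlyIncreasing-injective s↑ (trans sb≡i (sym sq≡i)))
    linear : det k M ≈ a *P det k M₁ +P c *P det k M₂
    linear = det-linear-in-column k M M₁ M₂ q a c
      (λ x b b≢q → ≈-reflexive (combineColumn-≢ a c (F x) (b≢q⇒sb≢i b≢q)))
      (λ x b b≢q → ≈-reflexive (trans (combineColumn-≢ a c (F x) (b≢q⇒sb≢i b≢q))
                                      (cong (F x) (sym (updateAt-minimal b q s b≢q)))))
      (λ x → ≈-reflexive (begin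
        combineColumn i a c (F x) (s q)            ≡⟨ cong (combineColumn i a c (F x)) sq≡i ⟩
        combineColumn i a c (F x) i                ≡⟨ combineColumn-≡ i a c (F x) ⟩
        a *P F x i +P c *P F x (suc i)             ≡⟨ cong₂ (λ y z → a *P F x y +P c *P F x z)
                                                         (sym sq≡i) (sym (updateAt-updates q s)) ⟩
        a *P F x (s q) +P c *P F x (s′ q)          ∎))
      where open ≡-Reasoning

  bidiagonal : (ℕ → Poly N) → (ℕ → Poly N) → (ℕ → Poly N) → ℕ → Poly N
  bidiagonal a c v j = a j *P v j +P c j *P v (suc j)

  bidiagonalBelow : ℕ → (ℕ → Poly N) → (ℕ → Poly N) → (ℕ → Poly N) → ℕ → Poly N
  bidiagonalBelow B a c v j with j ℕ.<? B
  ... | yes _ = bidiagonal a c v j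
  ... | no  _ = v j

  bidiagonalBelow-< : ∀ {B j} a c v → j < B → bidiagonalBelow B a c v j ≡ bidiagonal a c v j
  bidiagonalBelow-< {B} {j} a c v j<B with j ℕ.<? B
  ... | yes _  = refl
  ... | no j≮B = ⊥-elim (j≮B j<B)

  bidiagonalBelow-≮ : ∀ {B j} a c v → ¬ j < B → bidiagonalBelow B a c v j ≡ v j
  bidiagonalBelow-≮ {B} {j} a c v j≮B with j ℕ.<? B
  ... | yes j<B = ⊥-elim (j≮B j<B)
  ... | no _    = refl

  bidiagonalBelow-suc : ∀ B a c v j →
    bidiagonalBelow (suc B) a c v j ≡ combineColumn B (a B) (c B) (bidiagonalBelow B a c v) j
  bidiagonalBelow-suc B a c v j with j ℕ.≟ B
  ... | yes refl = trans (bidiagonalBelow-< a c v (ℕ.n<1+n j))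
    (cong₂ (λ x y → a j *P x +P c j *P y)
      (sym (bidiagonalBelow-≮ a c v (ℕ.<-irrefl refl)))
      (sym (bidiagonalBelow-≮ a c v (ℕ.<-asym (ℕ.n<1+n j)))))
  ... | no j≢B = off-diagonal (j ℕ.<? B)
    where
    off-diagonal : Dec (j < B) → bidiagonalBelow (suc B) a c v j ≡ bidiagonalBelow B a c v j
    off-diagonal (yes j<B) =
      trans (bidiagonalBelow-< a c v (ℕ.m<n⇒m<1+n j<B)) (sym (bidiagonalBelow-< a c v j<B))
    off-diagonal (no j≮B) =
      trans (bidiagonalBelow-≮ a c v (λ j<B+1 → j≢B (ℕ.≤∧≮⇒≡ (ℕ.s≤s⁻¹ j<B+1) j≮B)))
            (sym (bidiagonalBelow-≮ a c v j≮B))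

  bidiagonalBelow-preservesMaximalMinorsNonneg : ∀ B {a c} → (∀ j → NonnegCoeffs (a j)) → (∀ j → NonnegCoeffs (c j)) →
                                          PreservesMaximalMinorsNonneg (bidiagonalBelow B a c)
  bidiagonalBelow-preservesMaximalMinorsNonneg zero    {a} {c} a≥0 c≥0 k F F≥0 =
    MaximalMinorsNonneg-cong (λ x j → ≈-reflexive (sym (bidiagonalBelow-≮ {j = j} a c (F x) ℕ.n≮0))) F≥0
  bidiagonalBelow-preservesMaximalMinorsNonneg (suc B) {a} {c} a≥0 c≥0 k F F≥0 =
    MaximalMinorsNonneg-cong (λ x j → ≈-reflexive (sym (bidiagonalBelow-suc B a c (F x) j)))
      (combineColumn-preservesMaximalMinorsNonneg B (a≥0 B) (c≥0 B) k _
        (bidiagonalBelow-preservesMaximalMinorsNonneg B a≥0 c≥0 k F F≥0))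

  bidiagonal-preservesMaximalMinorsNonneg : ∀ {a c} → (∀ j → NonnegCoeffs (a j)) → (∀ j → NonnegCoeffs (c j)) →
                                     PreservesMaximalMinorsNonneg (bidiagonal a c)
  bidiagonal-preservesMaximalMinorsNonneg {a} {c} a≥0 c≥0 k F F≥0 s s↑ =
    NonnegCoeffs-≈ (det-cong k λ x b → ≈-reflexive (bidiagonalBelow-< a c (F x) (<-upperBound s b)))
      (bidiagonalBelow-preservesMaximalMinorsNonneg (upperBound s) a≥0 c≥0 k F F≥0 s s↑)

  MaximalMinorsNonneg-unitRow : ∀ {k} (F : Fin (suc k) → ℕ → Poly N) →
                         NonnegCoeffs (F Fin.zero 0) → (∀ j → F Fin.zero (suc j) ≈ 0P) →
                         MaximalMinorsNonneg k (F ∘ Fin.suc) → MaximalMinorsNonneg (suc k) F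
  MaximalMinorsNonneg-unitRow {k} F F₀₀≥0 F₀ₛ≈0 rest≥0 s s↑ =
    NonnegCoeffs-sumP (λ j → signP j (F Fin.zero (s j) *P minorDet j)) term≥0
    where
    minorDet : Fin (suc k) → Poly N
    minorDet j = det k (λ a b → F (Fin.suc a) (s (punchIn j b)))
    term≥0 : ∀ j → NonnegCoeffs (signP j (F Fin.zero (s j) *P minorDet j))
    term≥0 Fin.zero with s Fin.zero
    ... | zero  = NonnegCoeffs-*P (F Fin.zero 0) (minorDet Fin.zero) F₀₀≥0 rest≥0′
      where rest≥0′ = rest≥0 (s ∘ Fin.suc) (λ a b a<b → s↑ (Fin.suc a) (Fin.suc b) (s≤s a<b))
    ... | suc i = NonnegCoeffs-≈ (≈-sym (*P-cong (F₀ₛ≈0 i) (≈-refl {p = minorDet Fin.zero}))) NonnegCoeffs-0P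
    term≥0 (Fin.suc j) with s (Fin.suc j) | s↑ Fin.zero (Fin.suc j) (s≤s z≤n)
    ... | suc i | _ = NonnegCoeffs-≈ (≈-sym vanishes) NonnegCoeffs-0P
      where
      vanishes : signP (Fin.suc j) (F Fin.zero (suc i) *P minorDet (Fin.suc j)) ≈ 0P
      vanishes = ≈-trans (signP-cong (Fin.suc j) (*P-cong (F₀ₛ≈0 i) (≈-refl {p = minorDet (Fin.suc j)})))
                         (≈-reflexive (signP-0P (Fin.suc j)))

data ColumnOp (N : ℕ) : Set where
  reindexOp    : (ℕ → ℕ) → ColumnOp N
  bidiagonalOp : (ℕ → Poly N) → (ℕ → Poly N) → ColumnOp N

fixBelow : ℕ → (ℕ → ℕ) → ℕ → ℕ
fixBelow o h j with j ℕ.<? o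
... | yes _ = j
... | no  _ = o ℕ.+ h (j ℕ.∸ o)

fixBelow-< : ∀ {o} h {j} → j < o → fixBelow o h j ≡ j
fixBelow-< {o} h {j} j<o with j ℕ.<? o
... | yes _  = refl
... | no j≮o = ⊥-elim (j≮o j<o)

fixBelow-+ : ∀ o h i → fixBelow o h (o ℕ.+ i) ≡ o ℕ.+ h i
fixBelow-+ o h i with o ℕ.+ i ℕ.<? o
... | yes o+i<o = ⊥-elim (ℕ.<⇒≱ o+i<o (ℕ.m≤m+n o i))
... | no _      = cong (λ z → o ℕ.+ h z) (ℕ.m+n∸m≡n o i)

fixBelow-mono : ∀ o {h} → h Preserves _≤_ ⟶ _≤_ → fixBelow o h Preserves _≤_ ⟶ _≤_
fixBelow-mono o {h} h↗ {x} {y} x≤y with x ℕ.<? o | y ℕ.<? o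
... | yes _   | yes _   = x≤y
... | yes x<o | no _    = ℕ.≤-trans (ℕ.<⇒≤ x<o) (ℕ.m≤m+n o _)
... | no x≮o  | yes y<o = ⊥-elim (x≮o (ℕ.≤-<-trans x≤y y<o))
... | no _    | no _    = ℕ.+-monoʳ-≤ o (h↗ (ℕ.∸-monoˡ-≤ o x≤y))

module _ {N : ℕ} where

  padBelow : ℕ → Poly N → (ℕ → Poly N) → ℕ → Poly N
  padBelow o z a j with j ℕ.<? o
  ... | yes _ = z
  ... | no  _ = a (j ℕ.∸ o)

  padBelow-< : ∀ {o} z a {j} → j < o → padBelow o z a j ≡ z
  padBelow-< {o} z a {j} j<o with j ℕ.<? o
  ... | yes _  = refl
  ... | no j≮o = ⊥-elim (j≮o j<o)

  padBelow-+ : ∀ o z a i → padBelow o z a (o ℕ.+ i) ≡ a i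
  padBelow-+ o z a i with o ℕ.+ i ℕ.<? o
  ... | yes o+i<o = ⊥-elim (ℕ.<⇒≱ o+i<o (ℕ.m≤m+n o i))
  ... | no _      = cong a (ℕ.m+n∸m≡n o i)

  padBelow-nonneg : ∀ o {z a} → NonnegCoeffs z → (∀ j → NonnegCoeffs (a j)) → ∀ j → NonnegCoeffs (padBelow o z a j)
  padBelow-nonneg o z≥0 a≥0 j with j ℕ.<? o
  ... | yes _ = z≥0
  ... | no  _ = a≥0 (j ℕ.∸ o)

  applyOp : ColumnOp N → (ℕ → Poly N) → ℕ → Poly N
  applyOp (reindexOp h)      v j = v (h j)
  applyOp (bidiagonalOp a c) v   = bidiagonal a c v

  applyOps : List (ColumnOp N) → (ℕ → Poly N) → ℕ → Poly N
  applyOps []         v = v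
  applyOps (op ∷ ops) v = applyOps ops (applyOp op v)

  Admissible : ColumnOp N → Set
  Admissible (reindexOp h)      = h Preserves _≤_ ⟶ _≤_
  Admissible (bidiagonalOp a c) = (∀ j → NonnegCoeffs (a j)) × (∀ j → NonnegCoeffs (c j))

  applyOp-preservesMaximalMinorsNonneg : ∀ {op} → Admissible op → PreservesMaximalMinorsNonneg (applyOp op)
  applyOp-preservesMaximalMinorsNonneg {reindexOp h}      h↗          = reindex-preservesMaximalMinorsNonneg {h = h} h↗
  applyOp-preservesMaximalMinorsNonneg {bidiagonalOp a c} (a≥0 , c≥0) =
    bidiagonal-preservesMaximalMinorsNonneg {a = a} {c = c} a≥0 c≥0

  applyOps-preservesMaximalMinorsNonneg : ∀ {ops} → All Admissible ops → PreservesMaximalMinorsNonneg (applyOps ops)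
  applyOps-preservesMaximalMinorsNonneg []                k F F≥0 = F≥0
  applyOps-preservesMaximalMinorsNonneg (op-adm ∷ ops-adm) k F F≥0 =
    applyOps-preservesMaximalMinorsNonneg ops-adm k _ (applyOp-preservesMaximalMinorsNonneg op-adm k F F≥0)

  applyOp-cong : ∀ op {v w} → (∀ j → v j ≈ w j) → ∀ j → applyOp op v j ≈ applyOp op w j
  applyOp-cong (reindexOp h)      v≈w j = v≈w (h j)
  applyOp-cong (bidiagonalOp a c) v≈w j =
    +P-cong (*P-cong (≈-refl {p = a j}) (v≈w j)) (*P-cong (≈-refl {p = c j}) (v≈w (suc j)))

  applyOps-cong : ∀ ops {v w} → (∀ j → v j ≈ w j) → ∀ j → applyOps ops v j ≈ applyOps ops w j
  applyOps-cong []         v≈w = v≈w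
  applyOps-cong (op ∷ ops) v≈w = applyOps-cong ops (applyOp-cong op v≈w)

  shiftOp : ℕ → ColumnOp N → ColumnOp N
  shiftOp o (reindexOp h)      = reindexOp (fixBelow o h)
  shiftOp o (bidiagonalOp a c) = bidiagonalOp (padBelow o 1P a) (padBelow o 0P c)

  shiftOp-admissible : ∀ o {op} → Admissible op → Admissible (shiftOp o op)
  shiftOp-admissible o {reindexOp h}      h↗          = fixBelow-mono o h↗
  shiftOp-admissible o {bidiagonalOp a c} (a≥0 , c≥0) =
    padBelow-nonneg o NonnegCoeffs-1P a≥0 , padBelow-nonneg o NonnegCoeffs-0P c≥0

  applyOp-shiftOp-< : ∀ {o} op v {j} → j < o → applyOp (shiftOp o op) v j ≈ v j
  applyOp-shiftOp-< (reindexOp h)      v j<o = ≈-reflexive (cong v (fixBelow-< h j<o))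
  applyOp-shiftOp-< {o} (bidiagonalOp a c) v {j} j<o = begin
    padBelow o 1P a j *P v j +P padBelow o 0P c j *P v (suc j)
      ≡⟨ cong₂ (λ x y → x *P v j +P y *P v (suc j)) (padBelow-< 1P a j<o) (padBelow-< 0P c j<o) ⟩
    1P *P v j +P 0P
      ≈⟨ ≈-trans (+P-identityʳ (1P *P v j)) (*P-identityˡ (v j)) ⟩
    v j ∎
    where open SetoidReasoning (CommutativeRing.setoid (polyRing N))

  applyOp-shiftOp-+ : ∀ o op v i → applyOp (shiftOp o op) v (o ℕ.+ i) ≈ applyOp op (λ m → v (o ℕ.+ m)) i
  applyOp-shiftOp-+ o (reindexOp h)      v i = ≈-reflexive (cong v (fixBelow-+ o h i))
  applyOp-shiftOp-+ o (bidiagonalOp a c) v i = ≈-reflexive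
    (cong₂ (λ x y → x *P v (o ℕ.+ i) +P y) (padBelow-+ o 1P a i)
      (cong₂ _*P_ (padBelow-+ o 0P c i) (cong v (sym (ℕ.+-suc o i)))))

  applyOps-shift-< : ∀ {o} ops v {j} → j < o → applyOps (map (shiftOp o) ops) v j ≈ v j
  applyOps-shift-< []         v j<o = ≈-refl
  applyOps-shift-< (op ∷ ops) v j<o =
    ≈-trans (applyOps-shift-< ops _ j<o) (applyOp-shiftOp-< op v j<o)

  applyOps-shift-+ : ∀ o ops v i → applyOps (map (shiftOp o) ops) v (o ℕ.+ i) ≈ applyOps ops (λ m → v (o ℕ.+ m)) i
  applyOps-shift-+ o []         v i = ≈-refl
  applyOps-shift-+ o (op ∷ ops) v i =
    ≈-trans (applyOps-shift-+ o ops _ i) (applyOps-cong ops (applyOp-shiftOp-+ o op v) i)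

  shift-admissible : ∀ o {ops} → All Admissible ops → All Admissible (map (shiftOp o) ops)
  shift-admissible o []                = []
  shift-admissible o (op-adm ∷ ops-adm) = shiftOp-admissible o op-adm ∷ shift-admissible o ops-adm

-- Factorization of tridiagonal matrices

doubleMinusOne : ℕ → ℕ
doubleMinusOne zero          = zero
doubleMinusOne (suc zero)    = suc zero
doubleMinusOne (suc (suc k)) = suc (suc (doubleMinusOne (suc k)))

doubleMinusOne-mono : doubleMinusOne Preserves _≤_ ⟶ _≤_
doubleMinusOne-mono z≤n                         = z≤n
doubleMinusOne-mono (s≤s {n = zero}  z≤n)       = s≤s z≤n
doubleMinusOne-mono (s≤s {n = suc n} z≤n)       = s≤s z≤n
doubleMinusOne-mono (s≤s (s≤s m≤n))             = s≤s (s≤s (doubleMinusOne-mono (s≤s m≤n)))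

interleave : ∀ {A : Set} → (ℕ → A) → (ℕ → A) → ℕ → A
interleave e o zero          = e 0
interleave e o (suc zero)    = o 0
interleave e o (suc (suc m)) = interleave (e ∘ suc) (o ∘ suc) m

interleave-All : ∀ {A : Set} (P : A → Set) {e o : ℕ → A} → (∀ k → P (e k)) → (∀ k → P (o k)) →
                 ∀ m → P (interleave e o m)
interleave-All P Pe Po zero          = Pe 0
interleave-All P Pe Po (suc zero)    = Po 0
interleave-All P Pe Po (suc (suc m)) = interleave-All P (Pe ∘ suc) (Po ∘ suc) m

module _ {N : ℕ} where
  open PolySolver N using (solve; _:+_; _:*_; _:=_; con)

  jacobiRow : (t d : ℕ → Poly N) → ℕ → (ℕ → Poly N) → Poly N
  jacobiRow t d zero    v = (1P +P d 0) *P v 0 +P t 1 *P v 1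
  jacobiRow t d (suc i) v =
    v i +P (1P +P t (suc i) +P d (suc i)) *P v (suc i) +P t (suc (suc i)) *P v (suc (suc i))

  jacobiRow-cong : ∀ t d i {v w} → (∀ m → v m ≈ w m) → jacobiRow t d i v ≈ jacobiRow t d i w
  jacobiRow-cong t d zero    v≈w =
    +P-cong (*P-cong (≈-refl {p = 1P +P d 0}) (v≈w 0)) (*P-cong (≈-refl {p = t 1}) (v≈w 1))
  jacobiRow-cong t d (suc i) v≈w =
    +P-cong (+P-cong (v≈w i) (*P-cong (≈-refl {p = 1P +P t (suc i) +P d (suc i)}) (v≈w (suc i))))
            (*P-cong (≈-refl {p = t (suc (suc i))}) (v≈w (suc (suc i))))

  ones zeros : ℕ → Poly N
  ones  _ = 1P
  zeros _ = 0P

  -- On (v₀, v₁, …): duplicate every column; add t_{k+1}·v_{k+1} at the odd positions 2k+1; multiply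
  -- the even positions 2k by d_k; add to each even position the next one, then to each odd position
  -- the next one. Column 0 is now (1 + d₀)v₀ + t₁v₁ and column 2k+1 is
  -- v_k + (1 + t_{k+1} + d_{k+1})v_{k+1} + t_{k+2}v_{k+2}; keep exactly these columns.
  jacobiFactors : (t d : ℕ → Poly N) → List (ColumnOp N)
  jacobiFactors t d =
    reindexOp ℕ.⌊_/2⌋ ∷
    bidiagonalOp ones (interleave zeros (t ∘ suc)) ∷
    bidiagonalOp (interleave d ones) zeros ∷
    bidiagonalOp ones (interleave ones zeros) ∷
    bidiagonalOp ones (interleave zeros ones) ∷
    reindexOp doubleMinusOne ∷ []

  -- The factors are 2-periodic, so position i + 2 reduces definitionally to position i after shifting
  -- t, d and v by one. In the base cases each `O :* _` stands for a product 0P *P _, which is 0P.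
  jacobiFactors-correct : ∀ t d v i → applyOps (jacobiFactors t d) v i ≈ jacobiRow t d i v
  jacobiFactors-correct t d v zero =
    solve 4 (λ d₀ v₀ t₁ v₁ →
      let w₂₀ = I :* v₀ :+ O :* v₀
          w₂₁ = I :* v₀ :+ t₁ :* v₁
          w₄₀ = I :* (d₀ :* w₂₀ :+ O :* w₂₁) :+ I :* (I :* w₂₁ :+ O :* v₀)
      in  I :* w₄₀ :+ O :* v₀
       := (I :+ d₀) :* v₀ :+ t₁ :* v₁)
      ≈-refl (d 0) (v 0) (t 1) (v 1)
    where
    I O : ∀ {n} → PolySolver.Polynomial N n
    I = con (+ 1)
    O = con (+ 0)
  jacobiFactors-correct t d v (suc zero) =
    solve 6 (λ d₁ v₀ v₁ v₂ t₁ t₂ →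
      let w₂₁ = I :* v₀ :+ t₁ :* v₁
          w₂₂ = I :* v₁ :+ O :* v₁
          w₂₃ = I :* v₁ :+ t₂ :* v₂
          w₃₂ = d₁ :* w₂₂ :+ O :* v₀
          w₄₁ = I :* (I :* w₂₁ :+ O :* v₀) :+ O :* v₀
          w₄₂ = I :* w₃₂ :+ I :* (I :* w₂₃ :+ O :* v₀)
      in  I :* w₄₁ :+ I :* w₄₂
       := v₀ :+ (I :+ t₁ :+ d₁) :* v₁ :+ t₂ :* v₂)
      ≈-refl (d 1) (v 0) (v 1) (v 2) (t 1) (t 2)
    where
    I O : ∀ {n} → PolySolver.Polynomial N n
    I = con (+ 1)
    O = con (+ 0)
  jacobiFactors-correct t d v (suc (suc k)) = jacobiFactors-correct (t ∘ suc) (d ∘ suc) (v ∘ suc) (suc k)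

  jacobiFactors-admissible : ∀ {t d} → (∀ j → NonnegCoeffs (t j)) → (∀ j → NonnegCoeffs (d j)) →
                             All Admissible (jacobiFactors t d)
  jacobiFactors-admissible t≥0 d≥0 =
    ℕ.⌊n/2⌋-mono ∷
    (ones≥0 , interleave-All NonnegCoeffs zeros≥0 (t≥0 ∘ suc)) ∷
    (interleave-All NonnegCoeffs d≥0 ones≥0 , zeros≥0) ∷
    (ones≥0 , interleave-All NonnegCoeffs ones≥0 zeros≥0) ∷
    (ones≥0 , interleave-All NonnegCoeffs zeros≥0 ones≥0) ∷
    doubleMinusOne-mono ∷ []
    where
    ones≥0 : ∀ j → NonnegCoeffs (ones j)
    ones≥0 _ = NonnegCoeffs-1P
    zeros≥0 : ∀ j → NonnegCoeffs (zeros j)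
    zeros≥0 _ = NonnegCoeffs-0P

  jacobiAbove : ℕ → (t d : ℕ → Poly N) → (ℕ → Poly N) → ℕ → Poly N
  jacobiAbove o t d v j with j ℕ.<? o
  ... | yes _ = v j
  ... | no  _ = jacobiRow t d (j ℕ.∸ o) (λ i → v (o ℕ.+ i))

  jacobiAbove-< : ∀ {o} t d v {j} → j < o → jacobiAbove o t d v j ≡ v j
  jacobiAbove-< {o} t d v {j} j<o with j ℕ.<? o
  ... | yes _  = refl
  ... | no j≮o = ⊥-elim (j≮o j<o)

  jacobiAbove-+ : ∀ o t d v i → jacobiAbove o t d v (o ℕ.+ i) ≡ jacobiRow t d i (λ m → v (o ℕ.+ m))
  jacobiAbove-+ o t d v i with o ℕ.+ i ℕ.<? o
  ... | yes o+i<o = ⊥-elim (ℕ.<⇒≱ o+i<o (ℕ.m≤m+n o i))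
  ... | no _      = cong (λ z → jacobiRow t d z (λ m → v (o ℕ.+ m))) (ℕ.m+n∸m≡n o i)

  jacobiAbove-preservesMaximalMinorsNonneg : ∀ o {t d} → (∀ j → NonnegCoeffs (t j)) → (∀ j → NonnegCoeffs (d j)) →
                                      PreservesMaximalMinorsNonneg (jacobiAbove o t d)
  jacobiAbove-preservesMaximalMinorsNonneg o {t} {d} t≥0 d≥0 =
    PreservesMaximalMinorsNonneg-cong (λ v j → factorization v j (j ℕ.<? o))
      (applyOps-preservesMaximalMinorsNonneg (shift-admissible o (jacobiFactors-admissible {t = t} {d} t≥0 d≥0)))
    where
    shifted = map (shiftOp o) (jacobiFactors t d)
    factorization : ∀ v j → Dec (j < o) → applyOps shifted v j ≈ jacobiAbove o t d v j
    factorization v j (yes j<o) =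
      ≈-trans (applyOps-shift-< (jacobiFactors t d) v j<o) (≈-reflexive (sym (jacobiAbove-< t d v j<o)))
    factorization v j (no j≮o) =
      subst (λ z → applyOps shifted v z ≈ jacobiAbove o t d v z) (ℕ.m+[n∸m]≡n (ℕ.≮⇒≥ j≮o)) (begin
        applyOps shifted v (o ℕ.+ i)                         ≈⟨ applyOps-shift-+ o (jacobiFactors t d) v i ⟩
        applyOps (jacobiFactors t d) (λ m → v (o ℕ.+ m)) i   ≈⟨ jacobiFactors-correct t d _ i ⟩
        jacobiRow t d i (λ m → v (o ℕ.+ m))                  ≡⟨ sym (jacobiAbove-+ o t d v i) ⟩
        jacobiAbove o t d v (o ℕ.+ i)                        ∎)
      where
      open SetoidReasoning (CommutativeRing.setoid (polyRing N))
      i = j ℕ.∸ o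

-- The polynomials c_{n,k} and their Hankel matrix

repeatAt : ℕ → ℕ → ℕ
repeatAt p j = j ℕ.⊓ p ℕ.+ (j ℕ.∸ suc p)

repeatAt-mono : ∀ p → repeatAt p Preserves _≤_ ⟶ _≤_
repeatAt-mono p x≤y = ℕ.+-mono-≤ (ℕ.⊓-monoˡ-≤ p x≤y) (ℕ.∸-monoˡ-≤ (suc p) x≤y)

repeatAt-≤ : ∀ {p j} → j ≤ p → repeatAt p j ≡ j
repeatAt-≤ {p} {j} j≤p = begin
  j ℕ.⊓ p ℕ.+ (j ℕ.∸ suc p)  ≡⟨ cong₂ ℕ._+_ (ℕ.m≤n⇒m⊓n≡m j≤p) (ℕ.m≤n⇒m∸n≡0 (ℕ.m≤n⇒m≤1+n j≤p)) ⟩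
  j ℕ.+ 0                    ≡⟨ ℕ.+-identityʳ j ⟩
  j                          ∎
  where open ≡-Reasoning

repeatAt-+ : ∀ p i → repeatAt p (suc p ℕ.+ i) ≡ p ℕ.+ i
repeatAt-+ p i = cong₂ ℕ._+_ (ℕ.m≥n⇒m⊓n≡n (ℕ.m≤n⇒m≤1+n (ℕ.m≤m+n p i))) (ℕ.m+n∸m≡n (suc p) i)

module _ {n : ℕ} (ℓ : Fin n → ℕ) where

  private
    P : Set
    P = Poly (suc n)

  otherVariables : ℕ → P
  otherVariables zero    = sumP var
  otherVariables (suc i) = sumP (omit (tIdx ℓ (suc i)) var)

  σP-split : ∀ i → σP ≈ 1P +P tPoly ℓ (suc i) +P otherVariables (suc i)
  σP-split i = ≈-trans (+P-cong (≈-refl {p = 1P}) (sumP-omit var (tIdx ℓ (suc i))))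
                       (≈-sym (+P-assoc 1P (tPoly ℓ (suc i)) (otherVariables (suc i))))

  otherVariables-nonneg : ∀ i → NonnegCoeffs (otherVariables i)
  otherVariables-nonneg zero    = NonnegCoeffs-sumP var NonnegCoeffs-var
  otherVariables-nonneg (suc i) = NonnegCoeffs-sumP (omit (tIdx ℓ (suc i)) var) omitted-nonneg
    where
    omitted-nonneg : ∀ j → NonnegCoeffs (omit (tIdx ℓ (suc i)) var j)
    omitted-nonneg j with j Fin.≟ tIdx ℓ (suc i)
    ... | yes _ = NonnegCoeffs-0P
    ... | no  _ = NonnegCoeffs-var j

  cPoly-suc : ∀ m k → cPoly ℓ (suc m) k ≈ jacobiRow (tPoly ℓ) otherVariables k (cPoly ℓ m)
  cPoly-suc m zero    = ≈-refl
  cPoly-suc m (suc k) =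
    +P-cong (+P-cong (≈-refl {p = cPoly ℓ m k}) (*P-cong (σP-split k) (≈-refl {p = cPoly ℓ m (suc k)})))
            (≈-refl {p = tPoly ℓ (suc (suc k)) *P cPoly ℓ m (suc (suc k))})

  jacobi-preservesMaximalMinorsNonneg : ∀ o → PreservesMaximalMinorsNonneg (jacobiAbove o (tPoly ℓ) otherVariables)
  jacobi-preservesMaximalMinorsNonneg o =
    jacobiAbove-preservesMaximalMinorsNonneg o (λ i → NonnegCoeffs-var (tIdx ℓ i)) otherVariables-nonneg

  cRows : ∀ {k} → (Fin k → ℕ) → Fin k → ℕ → P
  cRows r x = cPoly ℓ (r x)

  CRowsNonnegBelow : ℕ → Set
  CRowsNonnegBelow m =
    ∀ k (r : Fin k → ℕ) → StrictlyIncreasing r → (∀ x → r x < m) → MaximalMinorsNonneg k (cRows r)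

  cRows-positive-step : ∀ {m} → CRowsNonnegBelow m →
                        ∀ k (r : Fin k → ℕ) → StrictlyIncreasing r → (∀ x → r x < suc m) → (∀ x → 0 < r x) →
                        MaximalMinorsNonneg k (cRows r)
  cRows-positive-step {m} ih k r r↑ r<m+1 r>0 =
    MaximalMinorsNonneg-cong previous-row
      (jacobi-preservesMaximalMinorsNonneg 0 k (cRows r′) (ih k r′ r′↑ r′<m))
    where
    r′ : Fin k → ℕ
    r′ x = ℕ.pred (r x)
    r≡1+r′ : ∀ x → r x ≡ suc (r′ x)
    r≡1+r′ x = sym (ℕ.suc-pred (r x) {{ℕ.>-nonZero (r>0 x)}})
    r′↑ : StrictlyIncreasing r′
    r′↑ a b a<b = ℕ.s≤s⁻¹ (subst₂ _<_ (r≡1+r′ a) (r≡1+r′ b) (r↑ a b a<b))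
    r′<m : ∀ x → r′ x < m
    r′<m x = ℕ.s≤s⁻¹ (subst (_< suc m) (r≡1+r′ x) (r<m+1 x))
    previous-row : ∀ x j → jacobiAbove 0 (tPoly ℓ) otherVariables (cPoly ℓ (r′ x)) j ≈ cPoly ℓ (r x) j
    previous-row x j = begin
      jacobiAbove 0 (tPoly ℓ) otherVariables (cPoly ℓ (r′ x)) j
        ≡⟨ jacobiAbove-+ 0 (tPoly ℓ) otherVariables (cPoly ℓ (r′ x)) j ⟩
      jacobiRow (tPoly ℓ) otherVariables j (cPoly ℓ (r′ x))
        ≈⟨ ≈-sym (cPoly-suc (r′ x) j) ⟩
      cPoly ℓ (suc (r′ x)) j
        ≡⟨ cong (λ z → cPoly ℓ z j) (sym (r≡1+r′ x)) ⟩
      cPoly ℓ (r x) j ∎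
      where open SetoidReasoning (CommutativeRing.setoid (polyRing (suc n)))

  cRows-maximalMinorsNonneg-bounded : ∀ m → CRowsNonnegBelow m
  cRows-maximalMinorsNonneg-bounded m       zero    r r↑ r<m s s↑ = NonnegCoeffs-1P
  cRows-maximalMinorsNonneg-bounded zero    (suc k) r r↑ r<m = ⊥-elim (ℕ.n≮0 (r<m Fin.zero))
  cRows-maximalMinorsNonneg-bounded (suc m) (suc k) r r↑ r<m = by-first-row (r Fin.zero) refl
    where
    rest-positive : ∀ x → r Fin.zero < r (Fin.suc x)
    rest-positive x = r↑ Fin.zero (Fin.suc x) (s≤s z≤n)
    by-first-row : ∀ r₀ → r Fin.zero ≡ r₀ → MaximalMinorsNonneg (suc k) (cRows r)
    by-first-row (suc _) r₀≡ = cRows-positive-step (cRows-maximalMinorsNonneg-bounded m) (suc k) r r↑ r<m λ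
      { Fin.zero    → subst (0 <_) (sym r₀≡) (s≤s z≤n)
      ; (Fin.suc x) → ℕ.≤-<-trans z≤n (rest-positive x) }
    by-first-row zero r₀≡ = MaximalMinorsNonneg-unitRow (cRows r)
      (subst (λ z → NonnegCoeffs (cPoly ℓ z 0)) (sym r₀≡) NonnegCoeffs-1P)
      (λ j → subst (λ z → cPoly ℓ z (suc j) ≈ 0P) (sym r₀≡) ≈-refl)
      (cRows-positive-step (cRows-maximalMinorsNonneg-bounded m) k (r ∘ Fin.suc)
        (λ a b a<b → r↑ (Fin.suc a) (Fin.suc b) (s≤s a<b)) (r<m ∘ Fin.suc)
        (λ x → subst (_< r (Fin.suc x)) r₀≡ (rest-positive x)))

  cRows-maximalMinorsNonneg : ∀ k (r : Fin k → ℕ) → StrictlyIncreasing r → MaximalMinorsNonneg k (cRows r)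
  cRows-maximalMinorsNonneg k r r↑ = cRows-maximalMinorsNonneg-bounded (upperBound r) k r r↑ (<-upperBound r)

  hankelStage : ∀ {k} → (Fin k → ℕ) → ℕ → Fin k → ℕ → P
  hankelStage r p x j = cPoly ℓ (r x ℕ.+ j ℕ.⊓ p) (j ℕ.∸ p)

  hankelStage-≤ : ∀ {k} (r : Fin k → ℕ) {p} x {j} → j ≤ p → hankelStage r p x j ≡ cPoly ℓ (r x ℕ.+ j) 0
  hankelStage-≤ r x j≤p =
    cong₂ (λ a b → cPoly ℓ (r x ℕ.+ a) b) (ℕ.m≤n⇒m⊓n≡m j≤p) (ℕ.m≤n⇒m∸n≡0 j≤p)

  hankelStage-+ : ∀ {k} (r : Fin k → ℕ) p x i → hankelStage r p x (p ℕ.+ i) ≡ cPoly ℓ (r x ℕ.+ p) i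
  hankelStage-+ r p x i =
    cong₂ (λ a b → cPoly ℓ (r x ℕ.+ a) b) (ℕ.m≥n⇒m⊓n≡n (ℕ.m≤m+n p i)) (ℕ.m+n∸m≡n p i)

  hankelStage-suc : ∀ {k} (r : Fin k → ℕ) p x j →
    jacobiAbove (suc p) (tPoly ℓ) otherVariables (λ i → hankelStage r p x (repeatAt p i)) j ≈ hankelStage r (suc p) x j
  hankelStage-suc r p x j = by-cases (j ℕ.<? suc p)
    where
    open SetoidReasoning (CommutativeRing.setoid (polyRing (suc n)))
    v : ℕ → P
    v i = hankelStage r p x (repeatAt p i)
    by-cases : Dec (j < suc p) → jacobiAbove (suc p) (tPoly ℓ) otherVariables v j ≈ hankelStage r (suc p) x j
    by-cases (yes j<p+1) = begin
      jacobiAbove (suc p) (tPoly ℓ) otherVariables v j   ≡⟨ jacobiAbove-< (tPoly ℓ) otherVariables v j<p+1 ⟩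
      hankelStage r p x (repeatAt p j)           ≡⟨ cong (hankelStage r p x) (repeatAt-≤ j≤p) ⟩
      hankelStage r p x j                        ≡⟨ hankelStage-≤ r x j≤p ⟩
      cPoly ℓ (r x ℕ.+ j) 0                      ≡⟨ sym (hankelStage-≤ r x (ℕ.m≤n⇒m≤1+n j≤p)) ⟩
      hankelStage r (suc p) x j                  ∎
      where j≤p = ℕ.s≤s⁻¹ j<p+1
    by-cases (no j≮p+1) =
      subst (λ z → jacobiAbove (suc p) (tPoly ℓ) otherVariables v z ≈ hankelStage r (suc p) x z)
        (ℕ.m+[n∸m]≡n (ℕ.≮⇒≥ j≮p+1)) (begin
        jacobiAbove (suc p) (tPoly ℓ) otherVariables v (suc p ℕ.+ i)
          ≡⟨ jacobiAbove-+ (suc p) (tPoly ℓ) otherVariables v i ⟩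
        jacobiRow (tPoly ℓ) otherVariables i (λ m → v (suc p ℕ.+ m))
          ≈⟨ jacobiRow-cong (tPoly ℓ) otherVariables i (λ m → ≈-reflexive
               (trans (cong (hankelStage r p x) (repeatAt-+ p m)) (hankelStage-+ r p x m))) ⟩
        jacobiRow (tPoly ℓ) otherVariables i (cPoly ℓ (r x ℕ.+ p))
          ≈⟨ ≈-sym (cPoly-suc (r x ℕ.+ p) i) ⟩
        cPoly ℓ (suc (r x ℕ.+ p)) i
          ≡⟨ cong (λ z → cPoly ℓ z i) (sym (ℕ.+-suc (r x) p)) ⟩
        cPoly ℓ (r x ℕ.+ suc p) i
          ≡⟨ sym (hankelStage-+ r (suc p) x i) ⟩
        hankelStage r (suc p) x (suc p ℕ.+ i) ∎)
      where i = j ℕ.∸ suc p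

  hankelStage-maximalMinorsNonneg : ∀ k (r : Fin k → ℕ) → StrictlyIncreasing r →
                                    ∀ p → MaximalMinorsNonneg k (hankelStage r p)
  hankelStage-maximalMinorsNonneg k r r↑ zero =
    MaximalMinorsNonneg-cong (λ x j → ≈-reflexive (sym (trans (hankelStage-+ r 0 x j)
                                                      (cong (λ z → cPoly ℓ z j) (ℕ.+-identityʳ (r x))))))
      (cRows-maximalMinorsNonneg k r r↑)
  hankelStage-maximalMinorsNonneg k r r↑ (suc p) =
    MaximalMinorsNonneg-cong (hankelStage-suc r p)
      (jacobi-preservesMaximalMinorsNonneg (suc p) k _
        (reindex-preservesMaximalMinorsNonneg (repeatAt-mono p) k (hankelStage r p) (hankelStage-maximalMinorsNonneg k r r↑ p)))

proposition3p5 : (n : ℕ) → 2 ≤ n → (ℓ : Fin n → ℕ) →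
    (∀ j → 1 ≤ ℓ j) → StrictlyIncreasing ℓ →
    IsStieltjesMomentSeq (λ m → cPoly ℓ m 0)
proposition3p5 n _ ℓ _ _ k r s r↑ s↑ =
  NonnegCoeffs-≈ (det-cong k λ x b → ≈-reflexive (hankelStage-≤ ℓ r x (ℕ.<⇒≤ (<-upperBound s b))))
    (hankelStage-maximalMinorsNonneg ℓ k r r↑ (upperBound s) s s↑)
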